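{- Let $k \geq 3$ and let $n_1 < n_2 < \cdots < n_k$ be positive integers with $\gcd(n_1,\ldots,n_k)=1$, and let $S=\langle n_1,\ldots,n_k\rangle$. For every $p \in \mathbb{N}$, \[ \sum_{\ell \in \mathsf{L}[n]} \ell^p = \frac{p!}{(k + p - 1)!\, (n_1 n_2 \cdots n_k)} h_p \bigg( \frac{1}{n_1}, \frac{1}{n_2}, \ldots, \frac{1}{n_k} \bigg) n^{k+p-1} + w_p(n) \] for all $n\in\mathbb{N}$, where $w_p(n)$ is a quasipolynomial of degree at most $k+p-2$ whose coefficients have period dividing $\operatorname{lcm}(n_1,n_2,\ldots,n_k)$.
   Context: $\mathbb{N}=\{0,1,2,\ldots\}$. $S=\langle n_1,\ldots,n_k\rangle=\{a_1n_1+\cdots+a_kn_k: a_i\in\mathbb{N}\}$. A factorization of $n$ is a tuple $(a_1,\ldots,a_k)\in\mathbb{N}^k$ with $n=\sum a_in_i$; its length is $\sum a_i$. The length multiset $\mathsf{L}[n]$ contains one copy of the length of each factorization of $n$, and the sum over $\mathsf{L}[n]$ counts multiplicity. $h_p(x_1,\ldots,x_k)=\sum_{1\le \alpha_1\le\cdots\le\alpha_p\le k} x_{\alpha_1}\cdots x_{\alpha_p}$ is the complete homogeneous symmetric polynomial of degree $p$. A quasipolynomial of degree $d$ is a function $f(n)=c_d(n)n^d+\cdots+c_1(n)n+c_0(n)$ whose coefficients $c_i$ are periodic functions of $n$. -}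

module Defs where

open import Data.Nat as ℕ using (ℕ; zero; suc; _+_; _*_; _∸_; _^_; _≤_; _<_)
open import Data.Nat.GCD using (gcd)
open import Data.Nat.LCM using (lcm)

open import Data.Fin using (Fin; toℕ)
open import Data.Bool using (Bool; true; false; _∧_)
open import Data.List using (List; []; _∷_; map; concatMap; upTo; filterᵇ; foldr; allFin)
open import Data.Vec as Vec using (Vec; []; _∷_; lookup)
open import Data.Integer using (+_)
open import Data.Rational as ℚ using (ℚ)
open import Relation.Nullary.Decidable using (⌊_⌋)
open import Data.Nat.ListAction using () renaming (sum to sumℕ)

gcdVec : ∀ {k} → Vec ℕ k → ℕ
gcdVec = Vec.foldr _ gcd 0

lcmVec : ∀ {k} → Vec ℕ k → ℕ
lcmVec = Vec.foldr _ lcm 1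

prodVec : ∀ {k} → Vec ℕ k → ℕ
prodVec = Vec.foldr _ _*_ 1

boxVecs : (k b : ℕ) → List (Vec ℕ k)
boxVecs zero    b = [] ∷ []
boxVecs (suc k) b = concatMap (λ a → map (a ∷_) (boxVecs k b)) (upTo (suc b))

dot : ∀ {k} → Vec ℕ k → Vec ℕ k → ℕ
dot a g = Vec.sum (Vec.zipWith _*_ a g)

-- the factorizations of n in ⟨g₁,…,g_k⟩ (all of them, provided every gᵢ ≥ 1,
-- since then aᵢ ≤ aᵢgᵢ ≤ n)
factorizations : ∀ {k} → Vec ℕ k → ℕ → List (Vec ℕ k)
factorizations {k} g n = filterᵇ (λ a → ⌊ dot a g ℕ.≟ n ⌋) (boxVecs k n)

len : ∀ {k} → Vec ℕ k → ℕ
len = Vec.sum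

-- Σ_{ℓ ∈ L[n]} ℓ^p  (multiset sum: one term per factorization)
lengthPowerSum : ∀ {k} → Vec ℕ k → ℕ → ℕ → ℕ
lengthPowerSum g p n = sumℕ (map (λ a → len a ^ p) (factorizations g n))

finVecs : (p k : ℕ) → List (Vec (Fin k) p)
finVecs zero    k = [] ∷ []
finVecs (suc p) k = concatMap (λ i → map (i ∷_) (finVecs p k)) (allFin k)

nondecreasing : ∀ {p k} → Vec (Fin k) p → Bool
nondecreasing [] = true
nondecreasing (i ∷ []) = true
nondecreasing (i ∷ j ∷ xs) = ⌊ toℕ i ℕ.≤? toℕ j ⌋ ∧ nondecreasing (j ∷ xs)

sumℚ : List ℚ → ℚ
sumℚ = foldr ℚ._+_ ℚ.0ℚ

prodℚ : ∀ {m} → Vec ℚ m → ℚ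
prodℚ = Vec.foldr _ ℚ._*_ ℚ.1ℚ

h : (p : ℕ) → ∀ {k} → Vec ℚ k → ℚ
h p {k} x = sumℚ (map (λ α → prodℚ (Vec.map (lookup x) α))
                      (filterᵇ nondecreasing (finVecs p k)))

-- a / d as a rational; only used with d ≥ 1 (value at d = 0 is an arbitrary convention)
fracℕ : ℕ → ℕ → ℚ
fracℕ a zero    = ℚ.0ℚ
fracℕ a (suc d) = (+ a) ℚ./ suc d

natℚ : ℕ → ℚ
natℚ m = (+ m) ℚ./ 1

sumBelow : ℕ → (ℕ → ℚ) → ℚ
sumBelow m f = sumℚ (map f (upTo m))

module Submission where

-- Write F(n) = Σ_{ℓ ∈ L[n]} ℓ^p as a sum over factorizations and let Δ f = f(· + L) − f with
-- L = lcm(n₁, …, n_k).  Splitting off the multiplicity of a generator m gives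
--   F(n + m) = F′(n + m) + F(n) + F_δ(n),
-- where F′ counts factorizations over the other generators and F_δ uses the weight
-- (ℓ+1)^p − ℓ^p of lower degree.  As m divides L, induction on k and p shows Δ^(k+p) F = 0 and
-- that Δ^(k+p-1) F has period m; the count being symmetric in the generators, this holds for every
-- nᵢ, so Δ^(k+p-1) F has period gcd = 1 and is a constant κ.  Summing the same splitting over one
-- period gives recursions for L κ matching those of the complete homogeneous polynomials, so
-- κ = p! L^(k+p-1) h_p(1/n₁, …, 1/n_k) / (n₁ ⋯ n_k).  Finally a function annihilated by Δ^D is a
-- quasipolynomial of degree < D with L-periodic coefficients; apply this to F − C n^D with D = k+p-1
-- and C = κ / (D! L^D), the leading coefficient of the theorem, since Δ^D (C n^D) = κ.

open import Defs

module LengthSums where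

  open import Data.Nat as ℕ using (ℕ; zero; suc; _≤_; _<_; z≤n; s≤s; _^_; _!)
  import Data.Nat.Properties as ℕP
  open import Data.Nat.GCD using (gcd; gcd-GCD; module Bézout)
  open import Data.Nat.Divisibility using (_∣_; divides; ∣-trans)
  open import Data.Nat.LCM using (lcm; m∣lcm[m,n]; n∣lcm[m,n]; gcd*lcm)
  import Data.Integer as ℤ
  import Data.Integer.Properties as ℤP
  open import Data.Rational as ℚ using (ℚ; _+_; _*_; _-_; -_; 0ℚ; 1ℚ)
  import Data.Rational.Properties as ℚP
  import Data.Rational.Unnormalised as ℚᵘ
  import Data.Rational.Unnormalised.Properties as ℚᵘP
  open import Data.Rational.Solver using (module +-*-Solver)
  open +-*-Solver using (solve; _:+_; _:*_; _:-_; _:=_; con)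
  open import Data.Product using (_×_; _,_; proj₁)
  open import Relation.Nullary using (yes; no; ¬_)
  open import Data.Vec as Vec using (Vec; []; _∷_; lookup; removeAt)
  open import Data.Vec.Relation.Unary.All as All using (All; []; _∷_)
  import Data.Vec.Relation.Unary.All.Properties as AllP
  open import Data.Fin using (Fin; zero; suc; toℕ)
  open import Data.Empty using (⊥-elim)
  open import Data.Bool using (Bool; true; false; if_then_else_; _∧_)
  open import Data.List using (List; []; _∷_; map; _++_; concatMap; upTo; applyUpTo; filterᵇ; allFin; tabulate)
  open import Relation.Nullary.Decidable using (⌊_⌋)
  open import Data.Nat.ListAction using () renaming (sum to sumℕ)
  open import Relation.Binary.PropositionalEquality

  toℚᵘ-natℚ : ∀ a → ℚ.toℚᵘ (natℚ a) ℚᵘ.≃ ℚᵘ.mkℚᵘ (ℤ.+ a) 0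
  toℚᵘ-natℚ a = ℚP.toℚᵘ-fromℚᵘ _

  natℚ-+ : ∀ a b → natℚ (a ℕ.+ b) ≡ natℚ a + natℚ b
  natℚ-+ a b = ℚP.toℚᵘ-injective (begin
      ℚ.toℚᵘ (natℚ (a ℕ.+ b))                   ≈⟨ toℚᵘ-natℚ (a ℕ.+ b) ⟩
      ℚᵘ.mkℚᵘ (ℤ.+ (a ℕ.+ b)) 0                 ≈⟨ ℚᵘ.*≡* (cong (ℤ._* ℤ.+ 1) (trans (ℤP.pos-+ a b)
                                                    (sym (cong₂ ℤ._+_ (ℤP.*-identityʳ (ℤ.+ a)) (ℤP.*-identityʳ (ℤ.+ b)))))) ⟩
      ℚᵘ.mkℚᵘ (ℤ.+ a) 0 ℚᵘ.+ ℚᵘ.mkℚᵘ (ℤ.+ b) 0  ≈⟨ ℚᵘP.+-cong (toℚᵘ-natℚ a) (toℚᵘ-natℚ b) ⟨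
      ℚ.toℚᵘ (natℚ a) ℚᵘ.+ ℚ.toℚᵘ (natℚ b)      ≈⟨ ℚP.toℚᵘ-homo-+ (natℚ a) (natℚ b) ⟨
      ℚ.toℚᵘ (natℚ a + natℚ b)                  ∎)
    where open ℚᵘP.≃-Reasoning

  natℚ-* : ∀ a b → natℚ (a ℕ.* b) ≡ natℚ a * natℚ b
  natℚ-* a b = ℚP.toℚᵘ-injective (begin
      ℚ.toℚᵘ (natℚ (a ℕ.* b))                   ≈⟨ toℚᵘ-natℚ (a ℕ.* b) ⟩
      ℚᵘ.mkℚᵘ (ℤ.+ (a ℕ.* b)) 0                 ≈⟨ ℚᵘ.*≡* (cong (ℤ._* ℤ.+ 1) (ℤP.pos-* a b)) ⟩
      ℚᵘ.mkℚᵘ (ℤ.+ a) 0 ℚᵘ.* ℚᵘ.mkℚᵘ (ℤ.+ b) 0  ≈⟨ ℚᵘP.*-cong (toℚᵘ-natℚ a) (toℚᵘ-natℚ b) ⟨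
      ℚ.toℚᵘ (natℚ a) ℚᵘ.* ℚ.toℚᵘ (natℚ b)      ≈⟨ ℚP.toℚᵘ-homo-* (natℚ a) (natℚ b) ⟨
      ℚ.toℚᵘ (natℚ a * natℚ b)                  ∎)
    where open ℚᵘP.≃-Reasoning

  natℚ-^ : ∀ x k → natℚ (x ^ suc k) ≡ natℚ x * natℚ (x ^ k)
  natℚ-^ x k = natℚ-* x (x ^ k)

  fracℕ-split : ∀ a {d} → 0 < d → fracℕ a d ≡ natℚ a * fracℕ 1 d
  fracℕ-split a {suc d} _ = ℚP.toℚᵘ-injective (begin
      ℚ.toℚᵘ (fracℕ a (suc d))                       ≈⟨ ℚP.toℚᵘ-fromℚᵘ _ ⟩
      ℚᵘ.mkℚᵘ (ℤ.+ a) d                              ≈⟨ ℚᵘ.*≡* (cong₂ ℤ._*_ (sym (ℤP.*-identityʳ (ℤ.+ a)))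
                                                                (cong (λ x → ℤ.+ suc x) (ℕP.+-identityʳ d))) ⟩
      ℚᵘ.mkℚᵘ (ℤ.+ a) 0 ℚᵘ.* ℚᵘ.mkℚᵘ (ℤ.+ 1) d       ≈⟨ ℚᵘP.*-cong (toℚᵘ-natℚ a) (ℚP.toℚᵘ-fromℚᵘ _) ⟨
      ℚ.toℚᵘ (natℚ a) ℚᵘ.* ℚ.toℚᵘ (fracℕ 1 (suc d))  ≈⟨ ℚP.toℚᵘ-homo-* (natℚ a) (fracℕ 1 (suc d)) ⟨
      ℚ.toℚᵘ (natℚ a * fracℕ 1 (suc d))              ∎)
    where open ℚᵘP.≃-Reasoning

  natℚ-*-fracℕ-inverse : ∀ {m} → 0 < m → natℚ m * fracℕ 1 m ≡ 1ℚ
  natℚ-*-fracℕ-inverse {suc d} m>0 = trans (sym (fracℕ-split (suc d) m>0)) (ℚP.toℚᵘ-injective (begin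
      ℚ.toℚᵘ (fracℕ (suc d) (suc d))  ≈⟨ ℚP.toℚᵘ-fromℚᵘ _ ⟩
      ℚᵘ.mkℚᵘ (ℤ.+ suc d) d           ≈⟨ ℚᵘ.*≡* (ℤP.*-comm (ℤ.+ suc d) (ℤ.+ 1)) ⟩
      ℚᵘ.mkℚᵘ (ℤ.+ 1) 0               ∎))
    where open ℚᵘP.≃-Reasoning

  *-cancelʳ-natℚ : ∀ {a b : ℚ} {c} → 0 < c → a * natℚ c ≡ b * natℚ c → a ≡ b
  *-cancelʳ-natℚ {a} {b} {c} c>0 eq = begin
      a                         ≡⟨ sym (ℚP.*-identityʳ a) ⟩
      a * 1ℚ                    ≡⟨ cong (a *_) (sym (natℚ-*-fracℕ-inverse c>0)) ⟩
      a * (natℚ c * fracℕ 1 c)  ≡⟨ sym (ℚP.*-assoc a (natℚ c) (fracℕ 1 c)) ⟩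
      (a * natℚ c) * fracℕ 1 c  ≡⟨ cong (_* fracℕ 1 c) eq ⟩
      (b * natℚ c) * fracℕ 1 c  ≡⟨ ℚP.*-assoc b (natℚ c) (fracℕ 1 c) ⟩
      b * (natℚ c * fracℕ 1 c)  ≡⟨ cong (b *_) (natℚ-*-fracℕ-inverse c>0) ⟩
      b * 1ℚ                    ≡⟨ ℚP.*-identityʳ b ⟩
      b                         ∎
    where open ≡-Reasoning

  Σ< : ℕ → (ℕ → ℚ) → ℚ
  Σ< zero    f = 0ℚ
  Σ< (suc n) f = Σ< n f + f n

  Σ<-cong′ : ∀ n {f g : ℕ → ℚ} → (∀ i → i < n → f i ≡ g i) → Σ< n f ≡ Σ< n g
  Σ<-cong′ zero    f≡g = refl
  Σ<-cong′ (suc n) f≡g = cong₂ _+_ (Σ<-cong′ n (λ i i<n → f≡g i (ℕP.m≤n⇒m≤1+n i<n))) (f≡g n ℕP.≤-refl)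

  Σ<-cong : ∀ n {f g : ℕ → ℚ} → (∀ i → f i ≡ g i) → Σ< n f ≡ Σ< n g
  Σ<-cong n f≡g = Σ<-cong′ n (λ i _ → f≡g i)

  Σ<-+ : ∀ n (f g : ℕ → ℚ) → Σ< n (λ i → f i + g i) ≡ Σ< n f + Σ< n g
  Σ<-+ zero    f g = refl
  Σ<-+ (suc n) f g = trans (cong (_+ (f n + g n)) (Σ<-+ n f g))
    (solve 4 (λ a b c d → (a :+ b) :+ (c :+ d) := (a :+ c) :+ (b :+ d)) refl (Σ< n f) (Σ< n g) (f n) (g n))

  Σ<-*ˡ : ∀ n c (f : ℕ → ℚ) → Σ< n (λ i → c * f i) ≡ c * Σ< n f
  Σ<-*ˡ zero    c f = sym (ℚP.*-zeroʳ c)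
  Σ<-*ˡ (suc n) c f = trans (cong (_+ c * f n) (Σ<-*ˡ n c f)) (sym (ℚP.*-distribˡ-+ c (Σ< n f) (f n)))

  Σ<-0 : ∀ n → Σ< n (λ _ → 0ℚ) ≡ 0ℚ
  Σ<-0 zero    = refl
  Σ<-0 (suc n) = trans (ℚP.+-identityʳ _) (Σ<-0 n)

  Σ<-vanish : ∀ n (f : ℕ → ℚ) → (∀ i → i < n → f i ≡ 0ℚ) → Σ< n f ≡ 0ℚ
  Σ<-vanish n f f≡0 = trans (Σ<-cong′ n f≡0) (Σ<-0 n)

  Σ<-const : ∀ n c → Σ< n (λ _ → c) ≡ natℚ n * c
  Σ<-const zero    c = sym (ℚP.*-zeroˡ c)
  Σ<-const (suc n) c = begin
      Σ< n (λ _ → c) + c  ≡⟨ cong (_+ c) (Σ<-const n c) ⟩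
      natℚ n * c + c      ≡⟨ solve 2 (λ x c → x :* c :+ c := (x :+ con 1ℚ) :* c) refl (natℚ n) c ⟩
      (natℚ n + 1ℚ) * c   ≡⟨ cong (_* c) (sym (trans (cong natℚ (ℕP.+-comm 1 n)) (natℚ-+ n 1))) ⟩
      natℚ (suc n) * c    ∎
    where open ≡-Reasoning

  Σ<-head : ∀ n (f : ℕ → ℚ) → Σ< (suc n) f ≡ f 0 + Σ< n (λ i → f (suc i))
  Σ<-head zero    f = trans (ℚP.+-identityˡ (f 0)) (sym (ℚP.+-identityʳ (f 0)))
  Σ<-head (suc n) f = trans (cong (_+ f (suc n)) (Σ<-head n f)) (ℚP.+-assoc (f 0) _ _)

  Σ<-split : ∀ a b (f : ℕ → ℚ) → Σ< (a ℕ.+ b) f ≡ Σ< a f + Σ< b (λ i → f (a ℕ.+ i))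
  Σ<-split a zero    f = trans (cong (λ x → Σ< x f) (ℕP.+-identityʳ a)) (sym (ℚP.+-identityʳ _))
  Σ<-split a (suc b) f = trans (cong (λ x → Σ< x f) (ℕP.+-suc a b))
    (trans (cong (_+ f (a ℕ.+ b)) (Σ<-split a b f)) (ℚP.+-assoc (Σ< a f) _ _))

  Σ<-comm : ∀ a b (f : ℕ → ℕ → ℚ) → Σ< a (λ i → Σ< b (f i)) ≡ Σ< b (λ j → Σ< a (λ i → f i j))
  Σ<-comm zero    b f = sym (Σ<-0 b)
  Σ<-comm (suc a) b f = trans (cong (_+ Σ< b (f a)) (Σ<-comm a b f))
    (sym (Σ<-+ b (λ j → Σ< a (λ i → f i j)) (f a)))

  Σ<-truncate : ∀ {t} a (f : ℕ → ℚ) → t ≤ a → (∀ i → t ≤ i → f i ≡ 0ℚ) → Σ< a f ≡ Σ< t f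
  Σ<-truncate {t} a f t≤a tail≡0 = begin
      Σ< a f                  ≡⟨ cong (λ x → Σ< x f) (sym (ℕP.m+[n∸m]≡n t≤a)) ⟩
      Σ< (t ℕ.+ (a ℕ.∸ t)) f  ≡⟨ Σ<-split t (a ℕ.∸ t) f ⟩
      Σ< t f + Σ< (a ℕ.∸ t) (λ i → f (t ℕ.+ i))
        ≡⟨ cong (Σ< t f +_) (Σ<-vanish (a ℕ.∸ t) _ (λ i _ → tail≡0 (t ℕ.+ i) (ℕP.m≤m+n t i))) ⟩
      Σ< t f + 0ℚ             ≡⟨ ℚP.+-identityʳ _ ⟩
      Σ< t f                  ∎
    where open ≡-Reasoning

  Periodic : ℕ → (ℕ → ℚ) → Set
  Periodic L f = ∀ n → f (n ℕ.+ L) ≡ f n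

  periodic-*ˡ : ∀ {m} r {f : ℕ → ℚ} → Periodic m f → Periodic (r ℕ.* m) f
  periodic-*ˡ     zero    {f} per n = cong f (ℕP.+-identityʳ n)
  periodic-*ˡ {m} (suc r) {f} per n = begin
      f (n ℕ.+ (m ℕ.+ r ℕ.* m))  ≡⟨ cong f (sym (ℕP.+-assoc n m (r ℕ.* m))) ⟩
      f (n ℕ.+ m ℕ.+ r ℕ.* m)    ≡⟨ periodic-*ˡ r per (n ℕ.+ m) ⟩
      f (n ℕ.+ m)                ≡⟨ per n ⟩
      f n                        ∎
    where open ≡-Reasoning

  +-comm-middle : ∀ n a b → n ℕ.+ a ℕ.+ b ≡ n ℕ.+ b ℕ.+ a
  +-comm-middle n a b = trans (ℕP.+-assoc n a b) (trans (cong (n ℕ.+_) (ℕP.+-comm a b)) (sym (ℕP.+-assoc n b a)))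

  periodic-shift : ∀ {L} s {f : ℕ → ℚ} → Periodic L f → Periodic L (λ n → f (n ℕ.+ s))
  periodic-shift {L} s {f} per n = trans (cong f (+-comm-middle n L s)) (per (n ℕ.+ s))

  Σ<-periodic-shift : ∀ L s (f : ℕ → ℚ) → Periodic L f → Σ< L (λ n → f (n ℕ.+ s)) ≡ Σ< L f
  Σ<-periodic-shift L zero    f per = Σ<-cong L (λ n → cong f (ℕP.+-identityʳ n))
  Σ<-periodic-shift L (suc s) f per = begin
      Σ< L (λ n → f (n ℕ.+ suc s))          ≡⟨ Σ<-cong L (λ n → cong f (ℕP.+-suc n s)) ⟩
      Σ< L (λ n → g (suc n))                ≡⟨ sym (ℚP.+-identityˡ _) ⟩
      0ℚ + Σ< L (λ n → g (suc n))
        ≡⟨ solve 2 (λ a b → con 0ℚ :+ b := (a :+ b) :- a) refl (g 0) (Σ< L (λ n → g (suc n))) ⟩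
      (g 0 + Σ< L (λ n → g (suc n))) - g 0  ≡⟨ cong (_- g 0) (sym (Σ<-head L g)) ⟩
      (Σ< L g + g L) - g 0                  ≡⟨ cong (λ x → (Σ< L g + x) - g 0) (periodic-shift s per 0) ⟩
      (Σ< L g + g 0) - g 0                  ≡⟨ solve 2 (λ a b → (a :+ b) :- b := a) refl (Σ< L g) (g 0) ⟩
      Σ< L g                                ≡⟨ Σ<-periodic-shift L s f per ⟩
      Σ< L f                                ∎
    where
    open ≡-Reasoning
    g : ℕ → ℚ
    g n = f (n ℕ.+ s)

  Σ<-periodic-* : ∀ m r (f : ℕ → ℚ) → Periodic m f → Σ< (r ℕ.* m) f ≡ natℚ r * Σ< m f
  Σ<-periodic-* m zero    f per = sym (ℚP.*-zeroˡ (Σ< m f))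
  Σ<-periodic-* m (suc r) f per = begin
      Σ< (m ℕ.+ r ℕ.* m) f      ≡⟨ Σ<-split m (r ℕ.* m) f ⟩
      Σ< m f + Σ< (r ℕ.* m) (λ i → f (m ℕ.+ i))
        ≡⟨ cong (Σ< m f +_) (Σ<-cong (r ℕ.* m) (λ i → trans (cong f (ℕP.+-comm m i)) (per i))) ⟩
      Σ< m f + Σ< (r ℕ.* m) f   ≡⟨ cong (Σ< m f +_) (Σ<-periodic-* m r f per) ⟩
      Σ< m f + natℚ r * Σ< m f  ≡⟨ solve 2 (λ a b → a :+ b :* a := (con 1ℚ :+ b) :* a) refl (Σ< m f) (natℚ r) ⟩
      (1ℚ + natℚ r) * Σ< m f    ≡⟨ cong (_* Σ< m f) (sym (natℚ-+ 1 r)) ⟩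
      natℚ (suc r) * Σ< m f     ∎
    where open ≡-Reasoning

  Δ : ℕ → (ℕ → ℚ) → ℕ → ℚ
  Δ L f n = f (n ℕ.+ L) - f n

  Δ^ : ℕ → ℕ → (ℕ → ℚ) → ℕ → ℚ
  Δ^ L zero    f = f
  Δ^ L (suc j) f = Δ L (Δ^ L j f)

  Δ^-cong : ∀ L j {f g : ℕ → ℚ} → (∀ n → f n ≡ g n) → ∀ n → Δ^ L j f n ≡ Δ^ L j g n
  Δ^-cong L zero    f≡g n = f≡g n
  Δ^-cong L (suc j) f≡g n = cong₂ _-_ (Δ^-cong L j f≡g (n ℕ.+ L)) (Δ^-cong L j f≡g n)

  Δ^-+ : ∀ L j (f g : ℕ → ℚ) n → Δ^ L j (λ n → f n + g n) n ≡ Δ^ L j f n + Δ^ L j g n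
  Δ^-+ L zero    f g n = refl
  Δ^-+ L (suc j) f g n = trans (cong₂ _-_ (Δ^-+ L j f g (n ℕ.+ L)) (Δ^-+ L j f g n))
    (solve 4 (λ a b c d → (a :+ b) :- (c :+ d) := (a :- c) :+ (b :- d)) refl
       (Δ^ L j f (n ℕ.+ L)) (Δ^ L j g (n ℕ.+ L)) (Δ^ L j f n) (Δ^ L j g n))

  Δ^-*ˡ : ∀ L j c (f : ℕ → ℚ) n → Δ^ L j (λ n → c * f n) n ≡ c * Δ^ L j f n
  Δ^-*ˡ L zero    c f n = refl
  Δ^-*ˡ L (suc j) c f n = trans (cong₂ _-_ (Δ^-*ˡ L j c f (n ℕ.+ L)) (Δ^-*ˡ L j c f n))
    (solve 3 (λ c a b → c :* a :- c :* b := c :* (a :- b)) refl c (Δ^ L j f (n ℕ.+ L)) (Δ^ L j f n))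

  Δ^-sub : ∀ L j (f g : ℕ → ℚ) n → Δ^ L j (λ n → f n - g n) n ≡ Δ^ L j f n - Δ^ L j g n
  Δ^-sub L zero    f g n = refl
  Δ^-sub L (suc j) f g n = trans (cong₂ _-_ (Δ^-sub L j f g (n ℕ.+ L)) (Δ^-sub L j f g n))
    (solve 4 (λ a b c d → (a :- b) :- (c :- d) := (a :- c) :- (b :- d)) refl
       (Δ^ L j f (n ℕ.+ L)) (Δ^ L j g (n ℕ.+ L)) (Δ^ L j f n) (Δ^ L j g n))

  Δ^-vanish : ∀ L j {f : ℕ → ℚ} → (∀ n → f n ≡ 0ℚ) → ∀ n → Δ^ L j f n ≡ 0ℚ
  Δ^-vanish L zero    f≡0 n = f≡0 n
  Δ^-vanish L (suc j) f≡0 n = trans (cong₂ _-_ (Δ^-vanish L j f≡0 (n ℕ.+ L)) (Δ^-vanish L j f≡0 n)) (ℚP.+-inverseʳ 0ℚ)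

  Δ^-shift : ∀ L j s (f : ℕ → ℚ) n → Δ^ L j (λ n → f (n ℕ.+ s)) n ≡ Δ^ L j f (n ℕ.+ s)
  Δ^-shift L zero    s f n = refl
  Δ^-shift L (suc j) s f n =
    cong₂ _-_ (trans (Δ^-shift L j s f (n ℕ.+ L)) (cong (Δ^ L j f) (+-comm-middle n L s))) (Δ^-shift L j s f n)

  Δ^-+-index : ∀ L i j (f : ℕ → ℚ) n → Δ^ L (i ℕ.+ j) f n ≡ Δ^ L i (Δ^ L j f) n
  Δ^-+-index L zero    j f n = refl
  Δ^-+-index L (suc i) j f n = cong₂ _-_ (Δ^-+-index L i j f (n ℕ.+ L)) (Δ^-+-index L i j f n)

  Δ^-suc : ∀ L j (f : ℕ → ℚ) n → Δ^ L (suc j) f n ≡ Δ^ L j (Δ L f) n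
  Δ^-suc L j f n = trans (cong (λ x → Δ^ L x f n) (ℕP.+-comm 1 j)) (Δ^-+-index L j 1 f n)

  periodic⇒Δ≡0 : ∀ {L} {f : ℕ → ℚ} → Periodic L f → ∀ n → Δ L f n ≡ 0ℚ
  periodic⇒Δ≡0 {f = f} per n = trans (cong (_- f n) (per n)) (ℚP.+-inverseʳ (f n))

  Δ≡0⇒periodic : ∀ {L} {f : ℕ → ℚ} → (∀ n → Δ L f n ≡ 0ℚ) → Periodic L f
  Δ≡0⇒periodic {L} {f} Δf≡0 n = begin
      f (n ℕ.+ L)                ≡⟨ solve 2 (λ a b → a := (a :- b) :+ b) refl (f (n ℕ.+ L)) (f n) ⟩
      (f (n ℕ.+ L) - f n) + f n  ≡⟨ cong (_+ f n) (Δf≡0 n) ⟩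
      0ℚ + f n                   ≡⟨ ℚP.+-identityˡ (f n) ⟩
      f n                        ∎
    where open ≡-Reasoning

  periodic-gcd : ∀ a b {f : ℕ → ℚ} → Periodic a f → Periodic b f → Periodic (gcd a b) f
  periodic-gcd a b {f} pa pb n with Bézout.identity (gcd-GCD a b)
  ... | Bézout.+- x y eq = begin
      f (n ℕ.+ gcd a b)              ≡⟨ periodic-*ˡ y pb (n ℕ.+ gcd a b) ⟨
      f (n ℕ.+ gcd a b ℕ.+ y ℕ.* b)  ≡⟨ cong f (trans (ℕP.+-assoc n (gcd a b) (y ℕ.* b)) (cong (n ℕ.+_) eq)) ⟩
      f (n ℕ.+ x ℕ.* a)              ≡⟨ periodic-*ˡ x pa n ⟩
      f n                            ∎
    where open ≡-Reasoning
  ... | Bézout.-+ x y eq = begin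
      f (n ℕ.+ gcd a b)              ≡⟨ periodic-*ˡ x pa (n ℕ.+ gcd a b) ⟨
      f (n ℕ.+ gcd a b ℕ.+ x ℕ.* a)  ≡⟨ cong f (trans (ℕP.+-assoc n (gcd a b) (x ℕ.* a)) (cong (n ℕ.+_) eq)) ⟩
      f (n ℕ.+ y ℕ.* b)              ≡⟨ periodic-*ˡ y pb n ⟩
      f n                            ∎
    where open ≡-Reasoning

  periodic-gcdVec : ∀ {k} (g : Vec ℕ k) {f : ℕ → ℚ} → (∀ i → Periodic (lookup g i) f) → Periodic (gcdVec g) f
  periodic-gcdVec []      {f} _   n = cong f (ℕP.+-identityʳ n)
  periodic-gcdVec (m ∷ g)     per = periodic-gcd m (gcdVec g) (per zero) (periodic-gcdVec g (λ i → per (suc i)))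

  periodic-1⇒constant : ∀ {f : ℕ → ℚ} → Periodic 1 f → ∀ n → f n ≡ f 0
  periodic-1⇒constant         per zero    = refl
  periodic-1⇒constant {f} per (suc n) = trans (cong f (ℕP.+-comm 1 n)) (trans (per n) (periodic-1⇒constant per n))

  -- Telescoping: Δ_L v(n) = Σ_{j<r} ψ(n + j m).
  Σ<-Δ-telescope : ∀ {L m} r (v ψ : ℕ → ℚ) → L ≡ r ℕ.* m → (∀ n → v (n ℕ.+ m) ≡ v n + ψ n) → Periodic L ψ →
    Σ< L (Δ L v) ≡ natℚ r * Σ< L ψ
  Σ<-Δ-telescope {L} {m} r v ψ L≡rm step perψ = begin
      Σ< L (Δ L v)                                 ≡⟨ Σ<-cong L Δv ⟩
      Σ< L (λ n → Σ< r (λ j → ψ (n ℕ.+ j ℕ.* m)))  ≡⟨ Σ<-comm L r (λ n j → ψ (n ℕ.+ j ℕ.* m)) ⟩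
      Σ< r (λ j → Σ< L (λ n → ψ (n ℕ.+ j ℕ.* m)))  ≡⟨ Σ<-cong r (λ j → Σ<-periodic-shift L (j ℕ.* m) ψ perψ) ⟩
      Σ< r (λ _ → Σ< L ψ)                          ≡⟨ Σ<-const r (Σ< L ψ) ⟩
      natℚ r * Σ< L ψ                              ∎
    where
    open ≡-Reasoning
    telescope : ∀ r n → v (n ℕ.+ r ℕ.* m) ≡ v n + Σ< r (λ j → ψ (n ℕ.+ j ℕ.* m))
    telescope zero    n = trans (cong v (ℕP.+-identityʳ n)) (sym (ℚP.+-identityʳ (v n)))
    telescope (suc r) n = begin
        v (n ℕ.+ (m ℕ.+ r ℕ.* m))
          ≡⟨ cong v (trans (cong (n ℕ.+_) (ℕP.+-comm m (r ℕ.* m))) (sym (ℕP.+-assoc n (r ℕ.* m) m))) ⟩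
        v (n ℕ.+ r ℕ.* m ℕ.+ m)                                   ≡⟨ step (n ℕ.+ r ℕ.* m) ⟩
        v (n ℕ.+ r ℕ.* m) + ψ (n ℕ.+ r ℕ.* m)                     ≡⟨ cong (_+ ψ (n ℕ.+ r ℕ.* m)) (telescope r n) ⟩
        v n + Σ< r (λ j → ψ (n ℕ.+ j ℕ.* m)) + ψ (n ℕ.+ r ℕ.* m)  ≡⟨ ℚP.+-assoc (v n) _ _ ⟩
        v n + Σ< (suc r) (λ j → ψ (n ℕ.+ j ℕ.* m))                ∎
    Δv : ∀ n → Δ L v n ≡ Σ< r (λ j → ψ (n ℕ.+ j ℕ.* m))
    Δv n = begin
      v (n ℕ.+ L) - v n                             ≡⟨ cong (λ z → v (n ℕ.+ z) - v n) L≡rm ⟩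
      v (n ℕ.+ r ℕ.* m) - v n                       ≡⟨ cong (_- v n) (telescope r n) ⟩
      (v n + Σ< r (λ j → ψ (n ℕ.+ j ℕ.* m))) - v n  ≡⟨ solve 2 (λ a s → (a :+ s) :- a := s) refl (v n) _ ⟩
      Σ< r (λ j → ψ (n ℕ.+ j ℕ.* m))                ∎

  poly : ℕ → (ℕ → ℕ → ℚ) → ℕ → ℚ
  poly d c n = Σ< d (λ i → c i n * natℚ (n ^ i))

  record Quasipolynomial (L d : ℕ) (f : ℕ → ℚ) : Set where
    constructor mkQP
    field
      coeff     : ℕ → ℕ → ℚ
      periodic  : ∀ i → Periodic L (coeff i)
      expansion : ∀ n → f n ≡ poly d coeff n

  module _ {L : ℕ} where

    QP-resp : ∀ {d} {f g : ℕ → ℚ} → Quasipolynomial L d f → (∀ n → f n ≡ g n) → Quasipolynomial L d g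
    QP-resp (mkQP c per f≡) f≡g = mkQP c per λ n → trans (sym (f≡g n)) (f≡ n)

    QP-0 : ∀ d → Quasipolynomial L d (λ _ → 0ℚ)
    QP-0 d = mkQP (λ _ _ → 0ℚ) (λ _ _ → refl) λ n → sym (trans (Σ<-cong d (λ i → ℚP.*-zeroˡ (natℚ (n ^ i)))) (Σ<-0 d))


    QP-+ : ∀ {d f g} → Quasipolynomial L d f → Quasipolynomial L d g → Quasipolynomial L d (λ n → f n + g n)
    QP-+ {d} {f} {g} (mkQP c per f≡) (mkQP c′ per′ g≡) =
      mkQP (λ i n → c i n + c′ i n) (λ i n → cong₂ _+_ (per i n) (per′ i n)) λ n → begin
        f n + g n                            ≡⟨ cong₂ _+_ (f≡ n) (g≡ n) ⟩
        poly d c n + poly d c′ n             ≡⟨ sym (Σ<-+ d _ _) ⟩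
        Σ< d (λ i → c i n * _ + c′ i n * _)  ≡⟨ Σ<-cong d (λ i → sym (ℚP.*-distribʳ-+ _ (c i n) (c′ i n))) ⟩
        poly d (λ i n → c i n + c′ i n) n    ∎
      where open ≡-Reasoning

    QP-*-periodic : ∀ {d f} (ρ : ℕ → ℚ) → Periodic L ρ → Quasipolynomial L d f → Quasipolynomial L d (λ n → ρ n * f n)
    QP-*-periodic {d} {f} ρ perρ (mkQP c per f≡) =
      mkQP (λ i n → ρ n * c i n) (λ i n → cong₂ _*_ (perρ n) (per i n)) λ n → begin
        ρ n * f n                       ≡⟨ cong (ρ n *_) (f≡ n) ⟩
        ρ n * poly d c n                ≡⟨ sym (Σ<-*ˡ d (ρ n) _) ⟩
        Σ< d (λ i → ρ n * (c i n * _))  ≡⟨ Σ<-cong d (λ i → sym (ℚP.*-assoc (ρ n) (c i n) _)) ⟩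
        poly d (λ i n → ρ n * c i n) n  ∎
      where open ≡-Reasoning

    updateCoeff : ℕ → (ℕ → ℚ) → (ℕ → ℕ → ℚ) → ℕ → ℕ → ℚ
    updateCoeff E ρ c i with i ℕ.≟ E
    ... | yes _ = ρ
    ... | no  _ = c i

    QP-extend : ∀ {E f} (ρ : ℕ → ℚ) → Periodic L ρ → Quasipolynomial L E f →
                Quasipolynomial L (suc E) (λ n → f n + ρ n * natℚ (n ^ E))
    QP-extend {E} ρ perρ (mkQP c per f≡) = mkQP (updateCoeff E ρ c) per′
        λ n → cong₂ _+_ (trans (f≡ n) (Σ<-cong′ E (λ i i<E → cong (_* _) (sym (below i n i<E))))) (cong (_* _) (sym (atE n)))
      where
      per′ : ∀ i → Periodic L (updateCoeff E ρ c i)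
      per′ i with i ℕ.≟ E
      ... | yes _ = perρ
      ... | no  _ = per i
      atE : ∀ n → updateCoeff E ρ c E n ≡ ρ n
      atE n with E ℕ.≟ E
      ... | yes _  = refl
      ... | no E≢E = ⊥-elim (E≢E refl)
      below : ∀ i n → i < E → updateCoeff E ρ c i n ≡ c i n
      below i n i<E with i ℕ.≟ E
      ... | yes refl = ⊥-elim (ℕP.<-irrefl refl i<E)
      ... | no  _    = refl

    QP-suc : ∀ {E f} → Quasipolynomial L E f → Quasipolynomial L (suc E) f
    QP-suc {E} {f} q = QP-resp (QP-extend {E} {f} (λ _ → 0ℚ) (λ _ → refl) q)
                                (λ n → trans (cong (f n +_) (ℚP.*-zeroˡ (natℚ (n ^ E)))) (ℚP.+-identityʳ (f n)))

    QP-monomial : ∀ E (ρ : ℕ → ℚ) → Periodic L ρ → Quasipolynomial L (suc E) (λ n → ρ n * natℚ (n ^ E))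
    QP-monomial E ρ perρ = QP-resp (QP-extend {E} {λ _ → 0ℚ} ρ perρ (QP-0 E)) (λ n → ℚP.+-identityˡ (ρ n * natℚ (n ^ E)))

    shiftCoeffs : (ℕ → ℕ → ℚ) → ℕ → ℕ → ℚ
    shiftCoeffs c zero    n = 0ℚ
    shiftCoeffs c (suc i) n = c i n

    poly-shiftCoeffs : ∀ d c n → poly (suc d) (shiftCoeffs c) n ≡ natℚ n * poly d c n
    poly-shiftCoeffs d c n = begin
        poly (suc d) (shiftCoeffs c) n                     ≡⟨ Σ<-head d _ ⟩
        0ℚ * natℚ 1 + Σ< d (λ i → c i n * natℚ (n ^ suc i))
          ≡⟨ cong₂ _+_ (ℚP.*-zeroˡ (natℚ 1)) (Σ<-cong d (λ i → cong (c i n *_) (natℚ-^ n i))) ⟩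
        0ℚ + Σ< d (λ i → c i n * (natℚ n * natℚ (n ^ i)))  ≡⟨ ℚP.+-identityˡ _ ⟩
        Σ< d (λ i → c i n * (natℚ n * natℚ (n ^ i)))
          ≡⟨ Σ<-cong d (λ i → solve 3 (λ a x y → a :* (x :* y) := x :* (a :* y)) refl (c i n) (natℚ n) _) ⟩
        Σ< d (λ i → natℚ n * (c i n * natℚ (n ^ i)))       ≡⟨ Σ<-*ˡ d (natℚ n) _ ⟩
        natℚ n * poly d c n                                ∎
      where open ≡-Reasoning

    QP-*-n : ∀ {d f} → Quasipolynomial L d f → Quasipolynomial L (suc d) (λ n → natℚ n * f n)
    QP-*-n {d} (mkQP c per f≡) = mkQP (shiftCoeffs c) per′ λ n → trans (cong (natℚ n *_) (f≡ n)) (sym (poly-shiftCoeffs d c n))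
      where
      per′ : ∀ i → Periodic L (shiftCoeffs c i)
      per′ zero    n = refl
      per′ (suc i) n = per i n

  binomialRemainder : ℕ → ℕ → ℕ → ℚ
  binomialRemainder L i n = natℚ ((n ℕ.+ L) ^ suc i) - natℚ (n ^ suc i) - natℚ (suc i) * natℚ L * natℚ (n ^ i)

  binomialRemainder-0 : ∀ L n → binomialRemainder L 0 n ≡ 0ℚ
  binomialRemainder-0 L n = begin
      natℚ ((n ℕ.+ L) ℕ.* 1) - natℚ (n ℕ.* 1) - natℚ 1 * natℚ L * natℚ 1
        ≡⟨ cong₂ (λ a b → a - b - 1ℚ * natℚ L * 1ℚ) (trans (natℚ-* (n ℕ.+ L) 1) (cong (_* 1ℚ) (natℚ-+ n L))) (natℚ-* n 1) ⟩
      (natℚ n + natℚ L) * 1ℚ - natℚ n * 1ℚ - 1ℚ * natℚ L * 1ℚ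
        ≡⟨ solve 2 (λ x l → (x :+ l) :* con 1ℚ :- x :* con 1ℚ :- con 1ℚ :* l :* con 1ℚ := con 0ℚ) refl (natℚ n) (natℚ L) ⟩
      0ℚ  ∎
    where open ≡-Reasoning

  -- Multiply (n + L)^(i+1) = R + n^(i+1) + (i+1) L n^i by n + L.
  binomialRemainder-suc : ∀ L i n → binomialRemainder L (suc i) n ≡
    (natℚ n * binomialRemainder L i n + natℚ L * binomialRemainder L i n) + natℚ (suc i) * natℚ L * natℚ L * natℚ (n ^ i)
  binomialRemainder-suc L i n = begin
      natℚ ((n ℕ.+ L) ^ suc (suc i)) - natℚ (n ^ suc (suc i)) - natℚ (suc (suc i)) * l * natℚ (n ^ suc i)
        ≡⟨ cong₂ (λ u v → u - v - natℚ (suc (suc i)) * l * natℚ (n ^ suc i))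
                 (trans (natℚ-^ (n ℕ.+ L) (suc i)) (cong (_* P) (natℚ-+ n L))) (natℚ-^ n (suc i)) ⟩
      (x + l) * P - x * natℚ (n ^ suc i) - natℚ (suc (suc i)) * l * natℚ (n ^ suc i)
        ≡⟨ cong₂ (λ u v → (x + l) * P - x * v - u * l * v) (natℚ-+ 1 (suc i)) (natℚ-^ n i) ⟩
      (x + l) * P - x * (x * a) - (1ℚ + k) * l * (x * a)
        ≡⟨ solve 5 (λ x l P a k → (x :+ l) :* P :- x :* (x :* a) :- (con 1ℚ :+ k) :* l :* (x :* a)
                                := (x :* (P :- x :* a :- k :* l :* a) :+ l :* (P :- x :* a :- k :* l :* a)) :+ k :* l :* l :* a)
                 refl x l P a k ⟩
      (x * R + l * R) + k * l * l * a
        ≡⟨ cong (λ z → (x * (P - z - k * l * a) + l * (P - z - k * l * a)) + k * l * l * a) (sym (natℚ-^ n i)) ⟩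
      (natℚ n * binomialRemainder L i n + l * binomialRemainder L i n) + k * l * l * a  ∎
    where
    open ≡-Reasoning
    x = natℚ n
    l = natℚ L
    P = natℚ ((n ℕ.+ L) ^ suc i)
    a = natℚ (n ^ i)
    k = natℚ (suc i)
    R = P - x * a - k * l * a

  QP-binomialRemainder : ∀ L i → Quasipolynomial L i (binomialRemainder L i)
  QP-binomialRemainder L zero    = QP-resp (QP-0 0) (λ n → sym (binomialRemainder-0 L n))
  QP-binomialRemainder L (suc i) = QP-resp
    (QP-+ (QP-+ (QP-*-n (QP-binomialRemainder L i))
                (QP-suc (QP-*-periodic (λ _ → natℚ L) (λ _ → refl) (QP-binomialRemainder L i))))
          (QP-monomial i (λ _ → natℚ (suc i) * natℚ L * natℚ L) (λ _ → refl)))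
    (λ n → sym (binomialRemainder-suc L i n))

  module _ {L : ℕ} where

    Δ-monomial : ∀ e {ρ : ℕ → ℚ} → Periodic L ρ → ∀ n →
      Δ L (λ n → ρ n * natℚ (n ^ suc e)) n ≡
      ρ n * binomialRemainder L e n + natℚ (suc e) * natℚ L * (ρ n * natℚ (n ^ e))
    Δ-monomial e {ρ} perρ n = begin
        ρ (n ℕ.+ L) * A - ρ n * B                                                     ≡⟨ cong (λ r → r * A - ρ n * B) (perρ n) ⟩
        ρ n * A - ρ n * B
          ≡⟨ solve 6 (λ r A B k l a → r :* A :- r :* B := r :* (A :- B :- k :* l :* a) :+ k :* l :* (r :* a))
                                                      refl (ρ n) A B (natℚ (suc e)) (natℚ L) (natℚ (n ^ e)) ⟩
        ρ n * binomialRemainder L e n + natℚ (suc e) * natℚ L * (ρ n * natℚ (n ^ e))  ∎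
      where
      open ≡-Reasoning
      A = natℚ ((n ℕ.+ L) ^ suc e)
      B = natℚ (n ^ suc e)

    QP-Δ-monomial : ∀ i {ρ : ℕ → ℚ} → Periodic L ρ → Quasipolynomial L i (Δ L (λ n → ρ n * natℚ (n ^ i)))
    QP-Δ-monomial zero    {ρ} perρ = QP-resp (QP-0 0) (λ n → sym (periodic⇒Δ≡0 (λ n → cong (_* 1ℚ) (perρ n)) n))
    QP-Δ-monomial (suc e) {ρ} perρ = QP-resp
      (QP-+ (QP-suc (QP-*-periodic ρ perρ (QP-binomialRemainder L e)))
            (QP-monomial e (λ n → natℚ (suc e) * natℚ L * ρ n) (λ n → cong (natℚ (suc e) * natℚ L *_) (perρ n))))
      (λ n → trans (cong (ρ n * binomialRemainder L e n +_) (ℚP.*-assoc (natℚ (suc e) * natℚ L) (ρ n) (natℚ (n ^ e))))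
                   (sym (Δ-monomial e perρ n)))

    QP-Δ-poly : ∀ {c} → (∀ i → Periodic L (c i)) → ∀ d → Quasipolynomial L d (Δ L (poly (suc d) c))
    QP-Δ-poly {c} per d = QP-resp (QP-+ (lower d) (QP-Δ-monomial d (per d)))
                                  (λ n → sym (Δ^-+ L 1 (poly d c) (λ n → c d n * natℚ (n ^ d)) n))
      where
      lower : ∀ d → Quasipolynomial L d (Δ L (poly d c))
      lower zero    = QP-resp (QP-0 0) (λ n → sym (ℚP.+-inverseʳ 0ℚ))
      lower (suc d) = QP-suc (QP-Δ-poly per d)

    QP-Δ : ∀ {d f} → Quasipolynomial L (suc d) f → Quasipolynomial L d (Δ L f)
    QP-Δ {d} (mkQP c per f≡) = QP-resp (QP-Δ-poly per d) (λ n → sym (cong₂ _-_ (f≡ (n ℕ.+ L)) (f≡ n)))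

    QP⇒Δ^≡0 : ∀ d {f} → Quasipolynomial L d f → ∀ n → Δ^ L d f n ≡ 0ℚ
    QP⇒Δ^≡0 zero    q n = Quasipolynomial.expansion q n
    QP⇒Δ^≡0 (suc d) {f} q n = trans (Δ^-suc L d f n) (QP⇒Δ^≡0 d (QP-Δ q) n)

    Δ^-monomial : ∀ e {ρ : ℕ → ℚ} → Periodic L ρ → ∀ n →
      Δ^ L e (λ n → ρ n * natℚ (n ^ e)) n ≡ ρ n * natℚ (e !) * natℚ (L ^ e)
    Δ^-monomial zero    {ρ} perρ n = sym (ℚP.*-identityʳ (ρ n * 1ℚ))
    Δ^-monomial (suc e) {ρ} perρ n = begin
        Δ^ L (suc e) (λ n → ρ n * natℚ (n ^ suc e)) n              ≡⟨ Δ^-suc L e _ n ⟩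
        Δ^ L e (Δ L (λ n → ρ n * natℚ (n ^ suc e))) n              ≡⟨ Δ^-cong L e (Δ-monomial e perρ) n ⟩
        Δ^ L e (λ n → ρ n * binomialRemainder L e n + kl * m n) n  ≡⟨ Δ^-+ L e _ (λ n → kl * m n) n ⟩
        Δ^ L e (λ n → ρ n * binomialRemainder L e n) n + Δ^ L e (λ n → kl * m n) n
          ≡⟨ cong₂ _+_ (QP⇒Δ^≡0 e (QP-*-periodic ρ perρ (QP-binomialRemainder L e)) n) (Δ^-*ˡ L e kl m n) ⟩
        0ℚ + kl * Δ^ L e m n                                       ≡⟨ cong (λ z → 0ℚ + kl * z) (Δ^-monomial e perρ n) ⟩
        0ℚ + kl * (ρ n * natℚ (e !) * natℚ (L ^ e))
          ≡⟨ solve 5 (λ k l r f p → con 0ℚ :+ k :* l :* (r :* f :* p) := r :* (k :* f) :* (l :* p)) refl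
                     (natℚ (suc e)) (natℚ L) (ρ n) (natℚ (e !)) (natℚ (L ^ e)) ⟩
        ρ n * (natℚ (suc e) * natℚ (e !)) * (natℚ L * natℚ (L ^ e))
          ≡⟨ sym (cong₂ (λ u v → ρ n * u * v) (natℚ-* (suc e) (e !)) (natℚ-* L (L ^ e))) ⟩
        ρ n * natℚ (suc e !) * natℚ (L ^ suc e)                    ∎
      where
      open ≡-Reasoning
      kl = natℚ (suc e) * natℚ L
      m : ℕ → ℚ
      m n = ρ n * natℚ (n ^ e)

    -- Peel off the top coefficient u / (E! L^E), where u = Δ^E w is L-periodic because Δ^(E+1) w = 0.
    Δ^≡0⇒QP : 0 < L → ∀ D {w : ℕ → ℚ} → (∀ n → Δ^ L D w n ≡ 0ℚ) → Quasipolynomial L D w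
    Δ^≡0⇒QP L>0 zero    Δ^w≡0 = QP-resp (QP-0 0) (λ n → sym (Δ^w≡0 n))
    Δ^≡0⇒QP L>0 (suc E) {w} Δ^w≡0 = QP-resp (QP-extend ρ perρ (Δ^≡0⇒QP L>0 E Δ^w′≡0))
                                             (λ n → solve 2 (λ a b → (a :- b) :+ b := a) refl (w n) (ρ n * natℚ (n ^ E)))
      where
      u = Δ^ L E w
      M = E ! ℕ.* L ^ E
      M>0 : 0 < M
      M>0 = ℕP.*-mono-≤ (ℕP.1≤n! E) (ℕP.m^n>0 L {{ℕ.>-nonZero L>0}} E)
      ρ : ℕ → ℚ
      ρ n = u n * fracℕ 1 M
      perρ : Periodic L ρ
      perρ n = cong (_* fracℕ 1 M) (Δ≡0⇒periodic {f = u} Δ^w≡0 n)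
      w′ : ℕ → ℚ
      w′ n = w n - ρ n * natℚ (n ^ E)
      Δ^w′≡0 : ∀ n → Δ^ L E w′ n ≡ 0ℚ
      Δ^w′≡0 n = begin
          Δ^ L E w′ n                                ≡⟨ Δ^-sub L E w (λ n → ρ n * natℚ (n ^ E)) n ⟩
          u n - Δ^ L E (λ n → ρ n * natℚ (n ^ E)) n  ≡⟨ cong (λ z → u n - z) (Δ^-monomial E perρ n) ⟩
          u n - u n * fracℕ 1 M * natℚ (E !) * natℚ (L ^ E)
            ≡⟨ solve 4 (λ a i f p → a :- a :* i :* f :* p := a :- a :* ((f :* p) :* i)) refl (u n) (fracℕ 1 M) (natℚ (E !)) (natℚ (L ^ E)) ⟩
          u n - u n * ((natℚ (E !) * natℚ (L ^ E)) * fracℕ 1 M)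
            ≡⟨ cong (λ z → u n - u n * (z * fracℕ 1 M)) (sym (natℚ-* (E !) (L ^ E))) ⟩
          u n - u n * (natℚ M * fracℕ 1 M)           ≡⟨ cong (λ z → u n - u n * z) (natℚ-*-fracℕ-inverse M>0) ⟩
          u n - u n * 1ℚ                             ≡⟨ solve 1 (λ a → a :- a :* con 1ℚ := con 0ℚ) refl (u n) ⟩
          0ℚ                                         ∎
        where open ≡-Reasoning

  when≤ : ℕ → ℕ → ℚ → ℚ
  when≤ c t v with c ℕ.≤? t
  ... | yes _ = v
  ... | no  _ = 0ℚ

  when≤-yes : ∀ {c t} v → c ≤ t → when≤ c t v ≡ v
  when≤-yes {c} {t} v c≤t with c ℕ.≤? t
  ... | yes _   = refl
  ... | no  c≰t = ⊥-elim (c≰t c≤t)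

  when≤-no : ∀ {c t} v → ¬ c ≤ t → when≤ c t v ≡ 0ℚ
  when≤-no {c} {t} v c≰t with c ℕ.≤? t
  ... | yes c≤t = ⊥-elim (c≰t c≤t)
  ... | no  _   = refl

  when≤-+ : ∀ c t a b → when≤ c t (a + b) ≡ when≤ c t a + when≤ c t b
  when≤-+ c t a b with c ℕ.≤? t
  ... | yes _ = refl
  ... | no  _ = sym (ℚP.+-identityʳ 0ℚ)

  when≤-*ˡ : ∀ c t k a → when≤ c t (k * a) ≡ k * when≤ c t a
  when≤-*ˡ c t k a with c ℕ.≤? t
  ... | yes _ = refl
  ... | no  _ = sym (ℚP.*-zeroʳ k)

  when≤-cong : ∀ {c t c′ t′} {v v′ : ℚ} → (c ≤ t → c′ ≤ t′) → (c′ ≤ t′ → c ≤ t) → v ≡ v′ →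
    when≤ c t v ≡ when≤ c′ t′ v′
  when≤-cong {c} {t} {v = v} to from refl with c ℕ.≤? t
  ... | yes c≤t = sym (when≤-yes v (to c≤t))
  ... | no  c≰t = sym (when≤-no v (λ c′≤t′ → c≰t (from c′≤t′)))

  -- lengthSum g φ t = Σ φ(a₁ + ⋯ + a_k) over all a ∈ ℕ^k with a₁g₁ + ⋯ + a_kg_k = t.
  lengthSum : ∀ {k} → Vec ℕ k → (ℕ → ℚ) → ℕ → ℚ
  lengthSum []      φ zero    = φ 0
  lengthSum []      φ (suc t) = 0ℚ
  lengthSum (m ∷ g) φ t = Σ< (suc t) (λ x → when≤ (x ℕ.* m) t (lengthSum g (λ ℓ → φ (x ℕ.+ ℓ)) (t ℕ.∸ x ℕ.* m)))

  pow : ℕ → ℕ → ℚ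
  pow p ℓ = natℚ (ℓ ^ p)

  lengthSum-cong : ∀ {k} (g : Vec ℕ k) {φ ψ : ℕ → ℚ} → (∀ ℓ → φ ℓ ≡ ψ ℓ) → ∀ t → lengthSum g φ t ≡ lengthSum g ψ t
  lengthSum-cong []      φ≡ψ zero    = φ≡ψ 0
  lengthSum-cong []      φ≡ψ (suc t) = refl
  lengthSum-cong (m ∷ g) φ≡ψ t =
    Σ<-cong (suc t) (λ x → cong (when≤ (x ℕ.* m) t) (lengthSum-cong g (λ ℓ → φ≡ψ (x ℕ.+ ℓ)) (t ℕ.∸ x ℕ.* m)))

  lengthSum-+ : ∀ {k} (g : Vec ℕ k) (φ ψ : ℕ → ℚ) t →
    lengthSum g (λ ℓ → φ ℓ + ψ ℓ) t ≡ lengthSum g φ t + lengthSum g ψ t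
  lengthSum-+ []      φ ψ zero    = refl
  lengthSum-+ []      φ ψ (suc t) = sym (ℚP.+-identityʳ 0ℚ)
  lengthSum-+ (m ∷ g) φ ψ t = trans (Σ<-cong (suc t) λ x →
      trans (cong (when≤ (x ℕ.* m) t) (lengthSum-+ g (λ ℓ → φ (x ℕ.+ ℓ)) (λ ℓ → ψ (x ℕ.+ ℓ)) (t ℕ.∸ x ℕ.* m)))
            (when≤-+ (x ℕ.* m) t _ _))
    (Σ<-+ (suc t) _ _)

  lengthSum-*ˡ : ∀ {k} (g : Vec ℕ k) a (φ : ℕ → ℚ) t → lengthSum g (λ ℓ → a * φ ℓ) t ≡ a * lengthSum g φ t
  lengthSum-*ˡ []      a φ zero    = refl
  lengthSum-*ˡ []      a φ (suc t) = sym (ℚP.*-zeroʳ a)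
  lengthSum-*ˡ (m ∷ g) a φ t = trans (Σ<-cong (suc t) λ x →
      trans (cong (when≤ (x ℕ.* m) t) (lengthSum-*ˡ g a (λ ℓ → φ (x ℕ.+ ℓ)) (t ℕ.∸ x ℕ.* m)))
            (when≤-*ˡ (x ℕ.* m) t a _))
    (Σ<-*ˡ (suc t) a _)

  lengthSum-0 : ∀ {k} (g : Vec ℕ k) {φ} → (∀ ℓ → φ ℓ ≡ 0ℚ) → ∀ t → lengthSum g φ t ≡ 0ℚ
  lengthSum-0 g {φ} φ≡0 t = begin
      lengthSum g φ t                ≡⟨ lengthSum-cong g (λ ℓ → trans (φ≡0 ℓ) (sym (ℚP.*-zeroˡ 0ℚ))) t ⟩
      lengthSum g (λ _ → 0ℚ * 0ℚ) t  ≡⟨ lengthSum-*ˡ g 0ℚ (λ _ → 0ℚ) t ⟩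
      0ℚ * lengthSum g (λ _ → 0ℚ) t  ≡⟨ ℚP.*-zeroˡ (lengthSum g (λ _ → 0ℚ) t) ⟩
      0ℚ                             ∎
    where open ≡-Reasoning

  lengthSum-at0 : ∀ {k} (g : Vec ℕ k) φ → lengthSum g φ 0 ≡ φ 0
  lengthSum-at0 []      φ = refl
  lengthSum-at0 (m ∷ g) φ = trans (ℚP.+-identityˡ _) (trans (when≤-yes {0} {0} (lengthSum g φ 0) z≤n) (lengthSum-at0 g φ))

  c≤t⇒c+d≤t : ∀ c d t → c ≤ t → d ≤ t ℕ.∸ c → c ℕ.+ d ≤ t
  c≤t⇒c+d≤t c d t c≤t d≤t∸c = subst (_≤ t) (ℕP.+-comm d c) (ℕP.m≤o∸n⇒m+n≤o d c≤t d≤t∸c)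

  c+d≤t⇒d≤t∸c : ∀ c d t → c ℕ.+ d ≤ t → d ≤ t ℕ.∸ c
  c+d≤t⇒d≤t∸c c d t c+d≤t = ℕP.m+n≤o⇒m≤o∸n d (subst (_≤ t) (ℕP.+-comm c d) c+d≤t)

  m≤m*n : ∀ m {n} → 0 < n → m ≤ m ℕ.* n
  m≤m*n m {suc n} _ = ℕP.m≤m*n m (suc n)

  -- Either the first coordinate a₁ is 0, or a - e₁ is a factorization of t - g₁ of length one less.
  lengthSum-∷ : ∀ {k} m (g : Vec ℕ k) φ t → 0 < m →
    lengthSum (m ∷ g) φ t ≡ lengthSum g φ t + when≤ m t (lengthSum (m ∷ g) (λ ℓ → φ (suc ℓ)) (t ℕ.∸ m))
  lengthSum-∷ m g φ t m>0 = trans (Σ<-head t F) (cong₂ _+_ (when≤-yes {0} {t} (lengthSum g φ t) z≤n) rest)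
    where
    F : ℕ → ℚ
    F x = when≤ (x ℕ.* m) t (lengthSum g (λ ℓ → φ (x ℕ.+ ℓ)) (t ℕ.∸ x ℕ.* m))
    rest : Σ< t (λ y → F (suc y)) ≡ when≤ m t (lengthSum (m ∷ g) (λ ℓ → φ (suc ℓ)) (t ℕ.∸ m))
    rest with m ℕ.≤? t
    ... | no m≰t = Σ<-vanish t _ (λ y _ → when≤-no _ (λ m+ym≤t → m≰t (ℕP.≤-trans (ℕP.m≤m+n m (y ℕ.* m)) m+ym≤t)))
    ... | yes m≤t = trans (Σ<-truncate t _ s<t vanish) (Σ<-cong (suc s) shifted)
      where
      s = t ℕ.∸ m
      s+m≡t : s ℕ.+ m ≡ t
      s+m≡t = ℕP.m∸n+n≡m m≤t
      s<t : suc s ≤ t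
      s<t = subst (suc s ≤_) s+m≡t (subst (_≤ s ℕ.+ m) (ℕP.+-comm s 1) (ℕP.+-monoʳ-≤ s m>0))
      vanish : ∀ y → suc s ≤ y → F (suc y) ≡ 0ℚ
      vanish y s<y = when≤-no _ λ m+ym≤t → ℕP.<-irrefl refl (ℕP.≤-trans (subst (suc t ≤_) (ℕP.+-comm (y ℕ.* m) m)
        (subst (λ z → suc z ≤ y ℕ.* m ℕ.+ m) s+m≡t (ℕP.+-monoˡ-≤ m (ℕP.≤-trans s<y (m≤m*n y m>0))))) m+ym≤t)
      shifted : ∀ y → F (suc y) ≡ when≤ (y ℕ.* m) s (lengthSum g (λ ℓ → φ (suc (y ℕ.+ ℓ))) (s ℕ.∸ y ℕ.* m))
      shifted y = when≤-cong (c+d≤t⇒d≤t∸c m (y ℕ.* m) t) (c≤t⇒c+d≤t m (y ℕ.* m) t m≤t)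
        (cong (lengthSum g (λ ℓ → φ (suc (y ℕ.+ ℓ)))) (sym (ℕP.∸-+-assoc t m (y ℕ.* m))))

  lengthSum₂ : ∀ {k} → ℕ → ℕ → Vec ℕ k → (ℕ → ℚ) → ℕ → ℚ
  lengthSum₂ a b g φ t = Σ< (suc t) λ x → Σ< (suc t) λ y →
    when≤ (x ℕ.* a ℕ.+ y ℕ.* b) t (lengthSum g (λ ℓ → φ (x ℕ.+ (y ℕ.+ ℓ))) (t ℕ.∸ (x ℕ.* a ℕ.+ y ℕ.* b)))

  lengthSum≡lengthSum₂ : ∀ {k} a b (g : Vec ℕ k) φ t → 0 < b → lengthSum (a ∷ b ∷ g) φ t ≡ lengthSum₂ a b g φ t
  lengthSum≡lengthSum₂ a b g φ t b>0 = Σ<-cong (suc t) inner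
    where
    H : ℕ → ℕ → ℚ
    H x y = when≤ (x ℕ.* a ℕ.+ y ℕ.* b) t (lengthSum g (λ ℓ → φ (x ℕ.+ (y ℕ.+ ℓ))) (t ℕ.∸ (x ℕ.* a ℕ.+ y ℕ.* b)))
    inner : ∀ x → when≤ (x ℕ.* a) t (lengthSum (b ∷ g) (λ ℓ → φ (x ℕ.+ ℓ)) (t ℕ.∸ x ℕ.* a)) ≡ Σ< (suc t) (H x)
    inner x with x ℕ.* a ℕ.≤? t
    ... | no xa≰t = sym (Σ<-vanish (suc t) (H x) (λ y _ → when≤-no _ (λ le → xa≰t (ℕP.≤-trans (ℕP.m≤m+n (x ℕ.* a) (y ℕ.* b)) le))))
    ... | yes xa≤t = sym (trans (Σ<-truncate (suc t) (H x) (s≤s (ℕP.m∸n≤m t (x ℕ.* a))) vanish) (Σ<-cong (suc s) same))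
      where
      s = t ℕ.∸ x ℕ.* a
      vanish : ∀ y → suc s ≤ y → H x y ≡ 0ℚ
      vanish y s<y = when≤-no _ λ le →
        ℕP.<-irrefl refl (ℕP.≤-trans (ℕP.≤-trans s<y (m≤m*n y b>0)) (c+d≤t⇒d≤t∸c (x ℕ.* a) (y ℕ.* b) t le))
      same : ∀ y → H x y ≡ when≤ (y ℕ.* b) s (lengthSum g (λ ℓ → φ (x ℕ.+ (y ℕ.+ ℓ))) (s ℕ.∸ y ℕ.* b))
      same y = when≤-cong (c+d≤t⇒d≤t∸c (x ℕ.* a) (y ℕ.* b) t) (c≤t⇒c+d≤t (x ℕ.* a) (y ℕ.* b) t xa≤t)
                 (cong (lengthSum g _) (sym (ℕP.∸-+-assoc t (x ℕ.* a) (y ℕ.* b))))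

  lengthSum₂-comm : ∀ {k} a b (g : Vec ℕ k) φ t → lengthSum₂ a b g φ t ≡ lengthSum₂ b a g φ t
  lengthSum₂-comm a b g φ t = trans (Σ<-comm (suc t) (suc t) _) (Σ<-cong (suc t) (λ y → Σ<-cong (suc t) (λ x → swap x y)))
    where
    swap : ∀ x y → when≤ (x ℕ.* a ℕ.+ y ℕ.* b) t (lengthSum g (λ ℓ → φ (x ℕ.+ (y ℕ.+ ℓ))) (t ℕ.∸ (x ℕ.* a ℕ.+ y ℕ.* b)))
                 ≡ when≤ (y ℕ.* b ℕ.+ x ℕ.* a) t (lengthSum g (λ ℓ → φ (y ℕ.+ (x ℕ.+ ℓ))) (t ℕ.∸ (y ℕ.* b ℕ.+ x ℕ.* a)))
    swap x y rewrite ℕP.+-comm (x ℕ.* a) (y ℕ.* b) =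
      cong (when≤ (y ℕ.* b ℕ.+ x ℕ.* a) t) (lengthSum-cong g (λ ℓ → cong φ (trans (sym (ℕP.+-assoc x y ℓ))
        (trans (cong (ℕ._+ ℓ) (ℕP.+-comm x y)) (ℕP.+-assoc y x ℓ)))) (t ℕ.∸ (y ℕ.* b ℕ.+ x ℕ.* a)))

  lengthSum-swap : ∀ {k} a b (g : Vec ℕ k) φ t → 0 < a → 0 < b → lengthSum (a ∷ b ∷ g) φ t ≡ lengthSum (b ∷ a ∷ g) φ t
  lengthSum-swap a b g φ t a>0 b>0 =
    trans (lengthSum≡lengthSum₂ a b g φ t b>0) (trans (lengthSum₂-comm a b g φ t) (sym (lengthSum≡lengthSum₂ b a g φ t a>0)))

  lengthSum-toFront : ∀ {k} (g : Vec ℕ (suc k)) i → All (0 <_) g → ∀ φ t →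
    lengthSum g φ t ≡ lengthSum (lookup g i ∷ removeAt g i) φ t
  lengthSum-toFront (m ∷ g)     zero    _ φ t = refl
  lengthSum-toFront (m ∷ n ∷ g) (suc i) (m>0 ∷ pos) φ t = begin
      lengthSum (m ∷ n ∷ g) φ t
        ≡⟨ Σ<-cong (suc t) (λ x → cong (when≤ (x ℕ.* m) t)
             (lengthSum-toFront (n ∷ g) i pos (λ ℓ → φ (x ℕ.+ ℓ)) (t ℕ.∸ x ℕ.* m))) ⟩
      lengthSum (m ∷ lookup (n ∷ g) i ∷ removeAt (n ∷ g) i) φ t
        ≡⟨ lengthSum-swap m (lookup (n ∷ g) i) (removeAt (n ∷ g) i) φ t m>0 (AllP.lookup⁺ pos i) ⟩
      lengthSum (lookup (n ∷ g) i ∷ m ∷ removeAt (n ∷ g) i) φ t  ∎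
    where open ≡-Reasoning

  All-removeAt : ∀ {P : ℕ → Set} {k} {g : Vec ℕ (suc k)} → All P g → ∀ i → All P (removeAt g i)
  All-removeAt (_  ∷ ps)           zero    = ps
  All-removeAt (px ∷ ps@(_ ∷ _))   (suc i) = px ∷ All-removeAt ps i

  sumL : ∀ {A : Set} → (A → ℚ) → List A → ℚ
  sumL F xs = sumℚ (map F xs)

  sumL-cong : ∀ {A : Set} {F G : A → ℚ} xs → (∀ x → F x ≡ G x) → sumL F xs ≡ sumL G xs
  sumL-cong []       F≡G = refl
  sumL-cong (x ∷ xs) F≡G = cong₂ _+_ (F≡G x) (sumL-cong xs F≡G)

  sumL-0 : ∀ {A : Set} (xs : List A) → sumL (λ _ → 0ℚ) xs ≡ 0ℚ
  sumL-0 []       = refl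
  sumL-0 (x ∷ xs) = trans (ℚP.+-identityˡ _) (sumL-0 xs)

  sumL-*ˡ : ∀ {A : Set} (c : ℚ) (F : A → ℚ) xs → sumL (λ a → c * F a) xs ≡ c * sumL F xs
  sumL-*ˡ c F []       = sym (ℚP.*-zeroʳ c)
  sumL-*ˡ c F (x ∷ xs) = trans (cong (c * F x +_) (sumL-*ˡ c F xs)) (sym (ℚP.*-distribˡ-+ c (F x) _))

  sumL-map : ∀ {A B : Set} (F : B → ℚ) (f : A → B) xs → sumL F (map f xs) ≡ sumL (λ x → F (f x)) xs
  sumL-map F f []       = refl
  sumL-map F f (x ∷ xs) = cong (F (f x) +_) (sumL-map F f xs)

  sumL-++ : ∀ {A : Set} (F : A → ℚ) xs ys → sumL F (xs ++ ys) ≡ sumL F xs + sumL F ys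
  sumL-++ F []       ys = sym (ℚP.+-identityˡ _)
  sumL-++ F (x ∷ xs) ys = trans (cong (F x +_) (sumL-++ F xs ys)) (sym (ℚP.+-assoc (F x) _ _))

  sumL-concatMap : ∀ {A B : Set} (F : B → ℚ) (f : A → List B) xs → sumL F (concatMap f xs) ≡ sumL (λ x → sumL F (f x)) xs
  sumL-concatMap F f []       = refl
  sumL-concatMap F f (x ∷ xs) = trans (sumL-++ F (f x) (concatMap f xs)) (cong (sumL F (f x) +_) (sumL-concatMap F f xs))

  sumL-filterᵇ : ∀ {A : Set} (p : A → Bool) (F : A → ℚ) xs → sumL F (filterᵇ p xs) ≡ sumL (λ x → if p x then F x else 0ℚ) xs
  sumL-filterᵇ p F []       = refl
  sumL-filterᵇ p F (x ∷ xs) with p x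
  ... | true  = cong (F x +_) (sumL-filterᵇ p F xs)
  ... | false = trans (sumL-filterᵇ p F xs) (sym (ℚP.+-identityˡ _))

  sumL-applyUpTo : ∀ (F : ℕ → ℚ) (f : ℕ → ℕ) n → sumL F (applyUpTo f n) ≡ Σ< n (λ i → F (f i))
  sumL-applyUpTo F f zero    = refl
  sumL-applyUpTo F f (suc n) = trans (cong (F (f 0) +_) (sumL-applyUpTo F (λ i → f (suc i)) n)) (sym (Σ<-head n (λ i → F (f i))))

  natℚ-sum : ∀ {A : Set} (f : A → ℕ) xs → natℚ (sumℕ (map f xs)) ≡ sumL (λ x → natℚ (f x)) xs
  natℚ-sum f []       = refl
  natℚ-sum f (x ∷ xs) = trans (natℚ-+ (f x) _) (cong (natℚ (f x) +_) (natℚ-sum f xs))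

  if-cong : ∀ {b b′ : Bool} {x y : ℚ} → b ≡ b′ → (if b then x else y) ≡ (if b′ then x else y)
  if-cong refl = refl

  ≟-shift : ∀ c d t → c ≤ t → ⌊ c ℕ.+ d ℕ.≟ t ⌋ ≡ ⌊ d ℕ.≟ t ℕ.∸ c ⌋
  ≟-shift c d t c≤t with c ℕ.+ d ℕ.≟ t | d ℕ.≟ t ℕ.∸ c
  ... | yes _   | yes _   = refl
  ... | no  _   | no  _   = refl
  ... | yes c+d≡t | no d≢t∸c = ⊥-elim (d≢t∸c (trans (sym (ℕP.m+n∸m≡n c d)) (cong (ℕ._∸ c) c+d≡t)))
  ... | no c+d≢t  | yes d≡t∸c = ⊥-elim (c+d≢t (trans (cong (c ℕ.+_) d≡t∸c) (ℕP.m+[n∸m]≡n c≤t)))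

  ≟-overshoot : ∀ c d t → ¬ c ≤ t → ⌊ c ℕ.+ d ℕ.≟ t ⌋ ≡ false
  ≟-overshoot c d t c≰t with c ℕ.+ d ℕ.≟ t
  ... | yes c+d≡t = ⊥-elim (c≰t (subst (c ≤_) c+d≡t (ℕP.m≤m+n c d)))
  ... | no  _     = refl

  boxSum : ∀ {k} → ℕ → Vec ℕ k → (ℕ → ℚ) → ℕ → ℚ
  boxSum {k} B g φ t = sumL (λ a → if ⌊ dot a g ℕ.≟ t ⌋ then φ (len a) else 0ℚ) (boxVecs k B)

  -- Every factorization of t ≤ B lies in the box, since aᵢ ≤ aᵢgᵢ ≤ t.
  boxSum≡lengthSum : ∀ {k} (g : Vec ℕ k) → All (0 <_) g → ∀ B φ t → t ≤ B → boxSum B g φ t ≡ lengthSum g φ t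
  boxSum≡lengthSum []      _ B φ zero    _ = ℚP.+-identityʳ (φ 0)
  boxSum≡lengthSum []      _ B φ (suc t) _ = ℚP.+-identityʳ 0ℚ
  boxSum≡lengthSum {suc k} (m ∷ g) (m>0 ∷ pos) B φ t t≤B = begin
      boxSum B (m ∷ g) φ t
        ≡⟨ sumL-concatMap Ind (λ x → map (x ∷_) (boxVecs k B)) (upTo (suc B)) ⟩
      sumL (λ x → sumL Ind (map (x ∷_) (boxVecs k B))) (upTo (suc B))
        ≡⟨ sumL-applyUpTo (λ x → sumL Ind (map (x ∷_) (boxVecs k B))) (λ i → i) (suc B) ⟩
      Σ< (suc B) (λ x → sumL Ind (map (x ∷_) (boxVecs k B)))
        ≡⟨ Σ<-cong (suc B) slice ⟩
      Σ< (suc B) G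
        ≡⟨ Σ<-truncate (suc B) G (s≤s t≤B) vanish ⟩
      lengthSum (m ∷ g) φ t  ∎
    where
    open ≡-Reasoning
    Ind : Vec ℕ (suc k) → ℚ
    Ind a = if ⌊ dot a (m ∷ g) ℕ.≟ t ⌋ then φ (len a) else 0ℚ
    G : ℕ → ℚ
    G x = when≤ (x ℕ.* m) t (lengthSum g (λ ℓ → φ (x ℕ.+ ℓ)) (t ℕ.∸ x ℕ.* m))
    slice : ∀ x → sumL Ind (map (x ∷_) (boxVecs k B)) ≡ G x
    slice x with x ℕ.* m ℕ.≤? t
    ... | yes le = trans (sumL-map Ind (x ∷_) (boxVecs k B))
           (trans (sumL-cong (boxVecs k B) (λ a → if-cong (≟-shift (x ℕ.* m) (dot a g) t le)))
           (boxSum≡lengthSum g pos B (λ ℓ → φ (x ℕ.+ ℓ)) (t ℕ.∸ x ℕ.* m) (ℕP.≤-trans (ℕP.m∸n≤m t (x ℕ.* m)) t≤B)))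
    ... | no nle = trans (sumL-map Ind (x ∷_) (boxVecs k B))
           (trans (sumL-cong (boxVecs k B) (λ a → if-cong (≟-overshoot (x ℕ.* m) (dot a g) t nle))) (sumL-0 (boxVecs k B)))
    vanish : ∀ x → suc t ≤ x → G x ≡ 0ℚ
    vanish x t<x = when≤-no _ (λ le → ℕP.<-irrefl refl (ℕP.≤-trans (ℕP.≤-trans t<x (m≤m*n x m>0)) le))

  lengthPowerSum≡lengthSum : ∀ {k} (g : Vec ℕ k) → All (0 <_) g → ∀ p n →
    natℚ (lengthPowerSum g p n) ≡ lengthSum g (pow p) n
  lengthPowerSum≡lengthSum {k} g pos p n = begin
      natℚ (lengthPowerSum g p n)                      ≡⟨ natℚ-sum (λ a → len a ^ p) (factorizations g n) ⟩
      sumL (λ a → pow p (len a)) (factorizations g n)  ≡⟨ sumL-filterᵇ _ (λ a → pow p (len a)) (boxVecs k n) ⟩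
      boxSum n g (pow p) n                             ≡⟨ boxSum≡lengthSum g pos n (pow p) n ℕP.≤-refl ⟩
      lengthSum g (pow p) n                            ∎
    where open ≡-Reasoning

  sumFin : ∀ n → (Fin n → ℚ) → ℚ
  sumFin zero    f = 0ℚ
  sumFin (suc n) f = f zero + sumFin n (λ j → f (suc j))

  sumFin-cong : ∀ n {f g : Fin n → ℚ} → (∀ j → f j ≡ g j) → sumFin n f ≡ sumFin n g
  sumFin-cong zero    f≡g = refl
  sumFin-cong (suc n) f≡g = cong₂ _+_ (f≡g zero) (sumFin-cong n (λ j → f≡g (suc j)))

  sumL-tabulate : ∀ {A : Set} n (F : A → ℚ) (f : Fin n → A) → sumL F (tabulate f) ≡ sumFin n (λ j → F (f j))
  sumL-tabulate zero    F f = refl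
  sumL-tabulate (suc n) F f = cong (F (f zero) +_) (sumL-tabulate n F (λ j → f (suc j)))

  monomial : ∀ {k p} → Vec ℚ k → Vec (Fin k) p → ℚ
  monomial x α = prodℚ (Vec.map (lookup x) α)

  -- h_p(x_i, …, x_k)
  hFrom : ∀ {k} → Vec ℚ k → ℕ → Fin k → ℚ
  hFrom {k} x p i = sumL (monomial x) (filterᵇ (λ β → nondecreasing (i ∷ β)) (finVecs p k))

  h≡hFrom : ∀ {k} (x : Vec ℚ (suc k)) p → h p x ≡ hFrom x p zero
  h≡hFrom {k} x p = begin
      h p x
        ≡⟨ sumL-filterᵇ nondecreasing (monomial x) βs ⟩
      sumL (λ β → if nondecreasing β then monomial x β else 0ℚ) βs
        ≡⟨ sumL-cong βs (λ β → if-cong (from0 β)) ⟩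
      sumL (λ β → if nondecreasing (zero ∷ β) then monomial x β else 0ℚ) βs
        ≡⟨ sumL-filterᵇ (λ β → nondecreasing (zero ∷ β)) (monomial x) βs ⟨
      hFrom x p zero  ∎
    where
    open ≡-Reasoning
    from0 : ∀ {q} (β : Vec (Fin (suc k)) q) → nondecreasing β ≡ nondecreasing (zero ∷ β)
    from0 []      = refl
    from0 (b ∷ β) = refl
    βs = finVecs p (suc k)

  hFrom-suc : ∀ {k} (x : Vec ℚ k) p i →
    hFrom x (suc p) i ≡ sumFin k (λ j → if ⌊ toℕ i ℕ.≤? toℕ j ⌋ then lookup x j * hFrom x p j else 0ℚ)
  hFrom-suc {k} x p i = begin
      hFrom x (suc p) i
        ≡⟨ sumL-filterᵇ _ (monomial x) (finVecs (suc p) k) ⟩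
      sumL Ind (concatMap (λ j → map (j ∷_) (finVecs p k)) (allFin k))
        ≡⟨ sumL-concatMap Ind (λ j → map (j ∷_) (finVecs p k)) (allFin k) ⟩
      sumL (λ j → sumL Ind (map (j ∷_) (finVecs p k))) (allFin k)                     ≡⟨ sumL-tabulate k _ (λ j → j) ⟩
      sumFin k (λ j → sumL Ind (map (j ∷_) (finVecs p k)))                            ≡⟨ sumFin-cong k first ⟩
      sumFin k (λ j → if ⌊ toℕ i ℕ.≤? toℕ j ⌋ then lookup x j * hFrom x p j else 0ℚ)  ∎
    where
    open ≡-Reasoning
    Ind : Vec (Fin k) (suc p) → ℚ
    Ind α = if nondecreasing (i ∷ α) then monomial x α else 0ℚ
    if-* : ∀ b c v → (if b then c * v else 0ℚ) ≡ c * (if b then v else 0ℚ)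
    if-* true  c v = refl
    if-* false c v = sym (ℚP.*-zeroʳ c)
    first : ∀ j → sumL Ind (map (j ∷_) (finVecs p k)) ≡ (if ⌊ toℕ i ℕ.≤? toℕ j ⌋ then lookup x j * hFrom x p j else 0ℚ)
    first j with ⌊ toℕ i ℕ.≤? toℕ j ⌋ in i≤j
    ... | true  = trans (sumL-map Ind (j ∷_) (finVecs p k))
          (trans (sumL-cong (finVecs p k) (λ β → trans (if-cong (cong (_∧ nondecreasing (j ∷ β)) i≤j))
                                                      (if-* (nondecreasing (j ∷ β)) (lookup x j) (monomial x β))))
          (trans (sumL-*ˡ (lookup x j) _ (finVecs p k))
          (cong (lookup x j *_) (sym (sumL-filterᵇ (λ β → nondecreasing (j ∷ β)) (monomial x) (finVecs p k))))))
    ... | false = trans (sumL-map Ind (j ∷_) (finVecs p k))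
          (trans (sumL-cong (finVecs p k) (λ β → if-cong (cong (_∧ nondecreasing (j ∷ β)) i≤j))) (sumL-0 (finVecs p k)))

  ≤ᵇ-suc : ∀ a b → ⌊ suc a ℕ.≤? suc b ⌋ ≡ ⌊ a ℕ.≤? b ⌋
  ≤ᵇ-suc a b with suc a ℕ.≤? suc b | a ℕ.≤? b
  ... | yes _        | yes _   = refl
  ... | no  _        | no  _   = refl
  ... | yes (s≤s le) | no  nle = ⊥-elim (nle le)
  ... | no  nle      | yes le  = ⊥-elim (nle (s≤s le))

  hFrom-suc-index : ∀ {k} (x₁ : ℚ) (x : Vec ℚ k) p j → hFrom (x₁ ∷ x) p (suc j) ≡ hFrom x p j
  hFrom-suc-index x₁ x zero    j = refl
  hFrom-suc-index {k} x₁ x (suc p) j = begin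
      hFrom (x₁ ∷ x) (suc p) (suc j)
        ≡⟨ hFrom-suc (x₁ ∷ x) p (suc j) ⟩
      0ℚ + sumFin k (λ j′ → if ⌊ suc (toℕ j) ℕ.≤? suc (toℕ j′) ⌋ then lookup x j′ * hFrom (x₁ ∷ x) p (suc j′) else 0ℚ)
        ≡⟨ ℚP.+-identityˡ _ ⟩
      sumFin k (λ j′ → if ⌊ suc (toℕ j) ℕ.≤? suc (toℕ j′) ⌋ then lookup x j′ * hFrom (x₁ ∷ x) p (suc j′) else 0ℚ)
        ≡⟨ sumFin-cong k (λ j′ → trans (if-cong (≤ᵇ-suc (toℕ j) (toℕ j′)))
              (cong (λ z → if ⌊ toℕ j ℕ.≤? toℕ j′ ⌋ then lookup x j′ * z else 0ℚ) (hFrom-suc-index x₁ x p j′))) ⟩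
      sumFin k (λ j′ → if ⌊ toℕ j ℕ.≤? toℕ j′ ⌋ then lookup x j′ * hFrom x p j′ else 0ℚ)
        ≡⟨ hFrom-suc x p j ⟨
      hFrom x (suc p) j  ∎
    where open ≡-Reasoning

  h-0 : ∀ {k} (x : Vec ℚ k) → h 0 x ≡ 1ℚ
  h-0 x = ℚP.+-identityʳ 1ℚ

  h-∷ : ∀ {k} p (x₁ : ℚ) (x : Vec ℚ k) → h (suc p) (x₁ ∷ x) ≡ x₁ * h p (x₁ ∷ x) + h (suc p) x
  h-∷ {k} p x₁ x = begin
      h (suc p) (x₁ ∷ x)               ≡⟨ h≡hFrom (x₁ ∷ x) (suc p) ⟩
      hFrom (x₁ ∷ x) (suc p) zero      ≡⟨ hFrom-suc (x₁ ∷ x) p zero ⟩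
      x₁ * hFrom (x₁ ∷ x) p zero + sumFin k (λ j → lookup x j * hFrom (x₁ ∷ x) p (suc j))
        ≡⟨ cong₂ _+_ (cong (x₁ *_) (sym (h≡hFrom (x₁ ∷ x) p)))
                     (trans (sumFin-cong k (λ j → cong (lookup x j *_) (hFrom-suc-index x₁ x p j))) (tail k x)) ⟩
      x₁ * h p (x₁ ∷ x) + h (suc p) x  ∎
    where
    open ≡-Reasoning
    tail : ∀ k (x : Vec ℚ k) → sumFin k (λ j → lookup x j * hFrom x p j) ≡ h (suc p) x
    tail zero    [] = refl
    tail (suc k) x  = sym (trans (h≡hFrom x (suc p)) (hFrom-suc x p zero))

  Polynomial : ℕ → (ℕ → ℚ) → Set
  Polynomial = Quasipolynomial 1

  δ : (ℕ → ℚ) → ℕ → ℚ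
  δ φ ℓ = φ (suc ℓ) - φ ℓ

  δ-polynomial : ∀ {d φ} → Polynomial (suc d) φ → Polynomial d (δ φ)
  δ-polynomial {φ = φ} P = QP-resp (QP-Δ P) (λ n → cong (λ z → φ z - φ n) (ℕP.+-comm n 1))

  pow-polynomial : ∀ p → Polynomial (suc p) (pow p)
  pow-polynomial p = QP-resp (QP-monomial p (λ _ → 1ℚ) (λ _ → refl)) (λ n → ℚP.*-identityˡ (pow p n))

  δ-pow : ∀ p ℓ → δ (pow (suc p)) ℓ ≡ natℚ (suc p) * pow p ℓ + binomialRemainder 1 p ℓ
  δ-pow p ℓ = trans (cong (λ z → natℚ (z ^ suc p) - natℚ (ℓ ^ suc p)) (ℕP.+-comm 1 ℓ))
    (solve 4 (λ A B k a → A :- B := k :* a :+ (A :- B :- k :* con 1ℚ :* a)) refl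
       (natℚ ((ℓ ℕ.+ 1) ^ suc p)) (natℚ (ℓ ^ suc p)) (natℚ (suc p)) (pow p ℓ))

  lengthSum-[]-shifted : ∀ φ {m} → 0 < m → ∀ n → lengthSum [] φ (n ℕ.+ m) ≡ 0ℚ
  lengthSum-[]-shifted φ {suc m} _ n rewrite ℕP.+-suc n m = refl

  lengthSum-step : ∀ {k} m (g : Vec ℕ k) → 0 < m → ∀ φ n →
    lengthSum (m ∷ g) φ (n ℕ.+ m) ≡ lengthSum g φ (n ℕ.+ m) + (lengthSum (m ∷ g) φ n + lengthSum (m ∷ g) (δ φ) n)
  lengthSum-step m g m>0 φ n = begin
      lengthSum (m ∷ g) φ (n ℕ.+ m)                                                  ≡⟨ lengthSum-∷ m g φ (n ℕ.+ m) m>0 ⟩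
      lengthSum g φ (n ℕ.+ m) + when≤ m (n ℕ.+ m) (lengthSum (m ∷ g) (λ ℓ → φ (suc ℓ)) (n ℕ.+ m ℕ.∸ m))
        ≡⟨ cong (lengthSum g φ (n ℕ.+ m) +_) (trans (when≤-yes _ (ℕP.m≤n+m m n))
                                                    (cong (lengthSum (m ∷ g) (λ ℓ → φ (suc ℓ))) (ℕP.m+n∸n≡m n m))) ⟩
      lengthSum g φ (n ℕ.+ m) + lengthSum (m ∷ g) (λ ℓ → φ (suc ℓ)) n
        ≡⟨ cong (lengthSum g φ (n ℕ.+ m) +_)
             (trans (lengthSum-cong (m ∷ g) (λ ℓ → solve 2 (λ a b → a := b :+ (a :- b)) refl (φ (suc ℓ)) (φ ℓ)) n)
                                                    (lengthSum-+ (m ∷ g) φ (δ φ) n)) ⟩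
      lengthSum g φ (n ℕ.+ m) + (lengthSum (m ∷ g) φ n + lengthSum (m ∷ g) (δ φ) n)  ∎
    where open ≡-Reasoning

  leadingCoeff : ∀ {k} → Vec ℕ (suc k) → ℕ → ℚ
  leadingCoeff {k} g p = fracℕ (p !) ((k ℕ.+ p) ! ℕ.* prodVec g) * h p (Vec.map (fracℕ 1) g)

  prodVec-pos : ∀ {k} (g : Vec ℕ k) → All (0 <_) g → 0 < prodVec g
  prodVec-pos []      []          = s≤s z≤n
  prodVec-pos (m ∷ g) (m>0 ∷ pos) = ℕP.*-mono-≤ m>0 (prodVec-pos g pos)

  lcm-pos : ∀ {m n} → 0 < m → 0 < n → 0 < lcm m n
  lcm-pos {m} {n} m>0 n>0 = ℕP.n≢0⇒n>0 λ lcm≡0 → ℕP.<⇒≢ (ℕP.*-mono-≤ m>0 n>0)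
    (sym (trans (sym (gcd*lcm m n)) (trans (cong (gcd m n ℕ.*_) lcm≡0) (ℕP.*-zeroʳ (gcd m n)))))

  lcmVec-pos : ∀ {k} (g : Vec ℕ k) → All (0 <_) g → 0 < lcmVec g
  lcmVec-pos []      []          = s≤s z≤n
  lcmVec-pos (m ∷ g) (m>0 ∷ pos) = lcm-pos m>0 (lcmVec-pos g pos)

  lookup∣lcmVec : ∀ {k} (g : Vec ℕ k) i → lookup g i ∣ lcmVec g
  lookup∣lcmVec (m ∷ g) zero    = m∣lcm[m,n] m (lcmVec g)
  lookup∣lcmVec (m ∷ g) (suc i) = ∣-trans (lookup∣lcmVec g i) (n∣lcm[m,n] m (lcmVec g))

  -- Exactly one t < m is a multiple of m.
  Σ<-lengthSum-single : ∀ {m} → 0 < m → Σ< m (lengthSum (m ∷ []) (pow 0)) ≡ 1ℚ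
  Σ<-lengthSum-single {suc m} m>0 = begin
      Σ< (suc m) f                  ≡⟨ Σ<-head m f ⟩
      f 0 + Σ< m (λ i → f (suc i))  ≡⟨ cong₂ _+_ (lengthSum-at0 (suc m ∷ []) (pow 0)) (Σ<-vanish m _ below) ⟩
      1ℚ + 0ℚ                       ≡⟨ ℚP.+-identityʳ 1ℚ ⟩
      1ℚ                            ∎
    where
    open ≡-Reasoning
    f = lengthSum (suc m ∷ []) (pow 0)
    below : ∀ i → i < m → f (suc i) ≡ 0ℚ
    below i i<m = trans (lengthSum-∷ (suc m) [] (pow 0) (suc i) m>0)
      (trans (cong (0ℚ +_) (when≤-no _ (λ m≤i → ℕP.<-irrefl refl (ℕP.≤-trans (s≤s i<m) m≤i)))) (ℚP.+-identityʳ 0ℚ))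

  module _ (L : ℕ) where

    Δ^-lengthSum-step : ∀ {k} m (g : Vec ℕ k) → 0 < m → ∀ j φ n →
      Δ^ L j (lengthSum (m ∷ g) φ) (n ℕ.+ m) ≡
      Δ^ L j (lengthSum g φ) (n ℕ.+ m) + (Δ^ L j (lengthSum (m ∷ g) φ) n + Δ^ L j (lengthSum (m ∷ g) (δ φ)) n)
    Δ^-lengthSum-step m g m>0 j φ n = begin
        Δ^ L j (lengthSum (m ∷ g) φ) (n ℕ.+ m)
          ≡⟨ Δ^-shift L j m _ n ⟨
        Δ^ L j (λ n → lengthSum (m ∷ g) φ (n ℕ.+ m)) n
          ≡⟨ Δ^-cong L j (lengthSum-step m g m>0 φ) n ⟩
        Δ^ L j (λ n → lengthSum g φ (n ℕ.+ m) + (lengthSum (m ∷ g) φ n + lengthSum (m ∷ g) (δ φ) n)) n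
          ≡⟨ Δ^-+ L j _ _ n ⟩
        Δ^ L j (λ n → lengthSum g φ (n ℕ.+ m)) n + Δ^ L j (λ n → lengthSum (m ∷ g) φ n + lengthSum (m ∷ g) (δ φ) n) n
          ≡⟨ cong₂ _+_ (Δ^-shift L j m (lengthSum g φ) n) (Δ^-+ L j (lengthSum (m ∷ g) φ) (lengthSum (m ∷ g) (δ φ)) n) ⟩
        Δ^ L j (lengthSum g φ) (n ℕ.+ m) + (Δ^ L j (lengthSum (m ∷ g) φ) n + Δ^ L j (lengthSum (m ∷ g) (δ φ)) n)  ∎
      where open ≡-Reasoning

    Δ^-lengthSum-[]-shifted≡0 : ∀ j φ {m} → 0 < m → ∀ n → Δ^ L j (lengthSum [] φ) (n ℕ.+ m) ≡ 0ℚ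
    Δ^-lengthSum-[]-shifted≡0 j φ {m} m>0 n = trans (sym (Δ^-shift L j m (lengthSum [] φ) n)) (Δ^-vanish L j (lengthSum-[]-shifted φ m>0) n)

    Generators : ∀ {k} → Vec ℕ k → Set
    Generators = All (λ m → 0 < m × m ∣ L)

    Δ^-index : ∀ {i j} (f : ℕ → ℚ) n → i ≡ j → Δ^ L i f n ≡ Δ^ L j f n
    Δ^-index f n refl = refl

    mutual
      Δ^-lengthSum-periodic : ∀ d {φ} → Polynomial (suc d) φ → ∀ {k m} {g : Vec ℕ k} → Generators (m ∷ g) →
        Periodic m (Δ^ L (k ℕ.+ d) (lengthSum (m ∷ g) φ))
      Δ^-lengthSum-periodic d {φ} P {k} {m} {g} G@((m>0 , _) ∷ G′) n = begin
          Δ^ L (k ℕ.+ d) (lengthSum (m ∷ g) φ) (n ℕ.+ m)      ≡⟨ Δ^-lengthSum-step m g m>0 (k ℕ.+ d) φ n ⟩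
          Δ^ L (k ℕ.+ d) (lengthSum g φ) (n ℕ.+ m) + (Δ^ L (k ℕ.+ d) (lengthSum (m ∷ g) φ) n + Δ^ L (k ℕ.+ d) (lengthSum (m ∷ g) (δ φ)) n)
            ≡⟨ cong₂ (λ a b → a + (Δ^ L (k ℕ.+ d) (lengthSum (m ∷ g) φ) n + b))
                     (Δ^-lengthSum-shifted≡0 d P m>0 G′ n) (Δ^-lengthSum≡0 d (δ-polynomial P) G n) ⟩
          0ℚ + (Δ^ L (k ℕ.+ d) (lengthSum (m ∷ g) φ) n + 0ℚ)  ≡⟨ solve 1 (λ u → con 0ℚ :+ (u :+ con 0ℚ) := u) refl _ ⟩
          Δ^ L (k ℕ.+ d) (lengthSum (m ∷ g) φ) n              ∎
        where open ≡-Reasoning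

      Δ^-lengthSum≡0 : ∀ d {φ} → Polynomial d φ → ∀ {k m} {g : Vec ℕ k} → Generators (m ∷ g) →
        ∀ n → Δ^ L (k ℕ.+ d) (lengthSum (m ∷ g) φ) n ≡ 0ℚ
      Δ^-lengthSum≡0 zero    {φ} P {k} {m} {g} G n =
        Δ^-vanish L (k ℕ.+ 0) (lengthSum-0 (m ∷ g) (Quasipolynomial.expansion P)) n
      Δ^-lengthSum≡0 (suc d) {φ} P {k} {m} {g} G@((_ , divides r L≡rm) ∷ _) n =
        trans (Δ^-index _ n (ℕP.+-suc k d))
              (periodic⇒Δ≡0 (subst (λ z → Periodic z (Δ^ L (k ℕ.+ d) (lengthSum (m ∷ g) φ))) (sym L≡rm)
                                   (periodic-*ˡ r (Δ^-lengthSum-periodic d P G))) n)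

      Δ^-lengthSum-shifted≡0 : ∀ d {φ} → Polynomial (suc d) φ → ∀ {k m} {g : Vec ℕ k} → 0 < m → Generators g →
        ∀ n → Δ^ L (k ℕ.+ d) (lengthSum g φ) (n ℕ.+ m) ≡ 0ℚ
      Δ^-lengthSum-shifted≡0 d {φ} P {g = []}      m>0 []      n = Δ^-lengthSum-[]-shifted≡0 d φ m>0 n
      Δ^-lengthSum-shifted≡0 d {φ} P {k = suc k} {m} {g = m′ ∷ g} m>0 G n =
        trans (Δ^-index _ (n ℕ.+ m) (sym (ℕP.+-suc k d))) (Δ^-lengthSum≡0 (suc d) P G (n ℕ.+ m))

    -- On the empty vector K is h_p() = [p = 0], so that K-∷-zero and K-∷-suc hold uniformly.
    K : ∀ {k} → Vec ℕ k → ℕ → ℚ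
    K []                 zero    = 1ℚ
    K []                 (suc p) = 0ℚ
    K {suc k} (m ∷ g) p = Σ< L (Δ^ L (k ℕ.+ p) (lengthSum (m ∷ g) (pow p)))

    Σ<-Δ^-lengthSum : ∀ E φ {k} m (g : Vec ℕ k) r → 0 < m → L ≡ r ℕ.* m →
      (∀ n → Δ^ L (suc E) (lengthSum g φ) (n ℕ.+ m) ≡ 0ℚ) → (∀ n → Δ^ L (suc E) (lengthSum (m ∷ g) (δ φ)) n ≡ 0ℚ) →
      Σ< L (Δ^ L (suc E) (lengthSum (m ∷ g) φ)) ≡
      natℚ r * (Σ< L (λ n → Δ^ L E (lengthSum g φ) (n ℕ.+ m)) + Σ< L (Δ^ L E (lengthSum (m ∷ g) (δ φ))))
    Σ<-Δ^-lengthSum E φ m g r m>0 L≡rm tail≡0 δ≡0 =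
      trans (Σ<-Δ-telescope r v (λ n → A n + B n) L≡rm step perψ) (cong (natℚ r *_) (Σ<-+ L A B))
      where
      v A B : ℕ → ℚ
      v     = Δ^ L E (lengthSum (m ∷ g) φ)
      A n   = Δ^ L E (lengthSum g φ) (n ℕ.+ m)
      B     = Δ^ L E (lengthSum (m ∷ g) (δ φ))
      step : ∀ n → v (n ℕ.+ m) ≡ v n + (A n + B n)
      step n = trans (Δ^-lengthSum-step m g m>0 E φ n) (solve 3 (λ a u b → a :+ (u :+ b) := u :+ (a :+ b)) refl (A n) (v n) (B n))
      perψ : Periodic L (λ n → A n + B n)
      perψ = Δ≡0⇒periodic λ n → begin
          (A (n ℕ.+ L) + B (n ℕ.+ L)) - (A n + B n)
            ≡⟨ solve 4 (λ a b c d → (a :+ b) :- (c :+ d) := (a :- c) :+ (b :- d)) refl (A (n ℕ.+ L)) (B (n ℕ.+ L)) (A n) (B n) ⟩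
          Δ L A n + Δ L B n
            ≡⟨ cong₂ _+_ (trans (cong₂ _-_ (cong (Δ^ L E (lengthSum g φ)) (+-comm-middle n L m)) refl) (tail≡0 n)) (δ≡0 n) ⟩
          0ℚ + 0ℚ  ≡⟨ ℚP.+-identityˡ 0ℚ ⟩
          0ℚ       ∎
        where open ≡-Reasoning

    Σ<-Δ^-lengthSum-shifted : ∀ p {k m m′} {g : Vec ℕ k} → Generators (m′ ∷ g) →
      Σ< L (λ n → Δ^ L (k ℕ.+ p) (lengthSum (m′ ∷ g) (pow p)) (n ℕ.+ m)) ≡ K (m′ ∷ g) p
    Σ<-Δ^-lengthSum-shifted p {k} {m} G = Σ<-periodic-shift L m _ (Δ≡0⇒periodic λ n →
      trans (Δ^-index _ n (sym (ℕP.+-suc k p))) (Δ^-lengthSum≡0 (suc p) (pow-polynomial p) G n))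

    Σ<-Δ^-lengthSum-δpow : ∀ p {k m} {g : Vec ℕ k} → Generators (m ∷ g) → ∀ {E} → E ≡ k ℕ.+ p →
      Σ< L (Δ^ L E (lengthSum (m ∷ g) (δ (pow (suc p))))) ≡ natℚ (suc p) * K (m ∷ g) p
    Σ<-Δ^-lengthSum-δpow p {k} {m} {g} G refl = trans (Σ<-cong L split) (Σ<-*ˡ L (natℚ (suc p)) _)
      where
      split : ∀ n → Δ^ L (k ℕ.+ p) (lengthSum (m ∷ g) (δ (pow (suc p)))) n ≡
                    natℚ (suc p) * Δ^ L (k ℕ.+ p) (lengthSum (m ∷ g) (pow p)) n
      split n = begin
          Δ^ L (k ℕ.+ p) (lengthSum (m ∷ g) (δ (pow (suc p)))) n
            ≡⟨ Δ^-cong L (k ℕ.+ p) (λ t → trans (lengthSum-cong (m ∷ g) (δ-pow p) t)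
                 (trans (lengthSum-+ (m ∷ g) (λ ℓ → natℚ (suc p) * pow p ℓ) (binomialRemainder 1 p) t)
                        (cong (_+ lengthSum (m ∷ g) (binomialRemainder 1 p) t) (lengthSum-*ˡ (m ∷ g) (natℚ (suc p)) (pow p) t)))) n ⟩
          Δ^ L (k ℕ.+ p) (λ t → natℚ (suc p) * lengthSum (m ∷ g) (pow p) t + lengthSum (m ∷ g) (binomialRemainder 1 p) t) n
            ≡⟨ Δ^-+ L (k ℕ.+ p) _ _ n ⟩
          Δ^ L (k ℕ.+ p) (λ t → natℚ (suc p) * lengthSum (m ∷ g) (pow p) t) n
            + Δ^ L (k ℕ.+ p) (lengthSum (m ∷ g) (binomialRemainder 1 p)) n
            ≡⟨ cong₂ _+_ (Δ^-*ˡ L (k ℕ.+ p) (natℚ (suc p)) _ n) (Δ^-lengthSum≡0 p (QP-binomialRemainder 1 p) G n) ⟩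
          natℚ (suc p) * Δ^ L (k ℕ.+ p) (lengthSum (m ∷ g) (pow p)) n + 0ℚ
            ≡⟨ ℚP.+-identityʳ _ ⟩
          natℚ (suc p) * Δ^ L (k ℕ.+ p) (lengthSum (m ∷ g) (pow p)) n  ∎
        where open ≡-Reasoning

    Σ<-Δ^-lengthSum-δpow0 : ∀ E {k} m (g : Vec ℕ k) → Σ< L (Δ^ L E (lengthSum (m ∷ g) (δ (pow 0)))) ≡ 0ℚ
    Σ<-Δ^-lengthSum-δpow0 E m g = Σ<-vanish L _ (λ n _ → Δ^-vanish L E (lengthSum-0 (m ∷ g) (λ _ → ℚP.+-inverseʳ 1ℚ)) n)

    K-single-0 : ∀ {m r} → 0 < m → L ≡ r ℕ.* m → K (m ∷ []) 0 ≡ natℚ r * 1ℚ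
    K-single-0 {m} {r} m>0 L≡rm = begin
        Σ< L f           ≡⟨ cong (λ z → Σ< z f) L≡rm ⟩
        Σ< (r ℕ.* m) f   ≡⟨ Σ<-periodic-* m r f (Δ^-lengthSum-periodic 0 (pow-polynomial 0) ((m>0 , divides r L≡rm) ∷ [])) ⟩
        natℚ r * Σ< m f  ≡⟨ cong (natℚ r *_) (Σ<-lengthSum-single m>0) ⟩
        natℚ r * 1ℚ      ∎
      where
      open ≡-Reasoning
      f = lengthSum (m ∷ []) (pow 0)

    K-∷-zero : ∀ {k m r} {g : Vec ℕ k} → Generators (m ∷ g) → L ≡ r ℕ.* m → K (m ∷ g) 0 ≡ natℚ r * K g 0
    K-∷-zero {m = m} {r} {[]} ((m>0 , _) ∷ _) L≡rm = K-single-0 {m} {r} m>0 L≡rm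
    K-∷-zero {suc k} {m} {r} {m′ ∷ g} G@((m>0 , _) ∷ G′) L≡rm = begin
        K (m ∷ m′ ∷ g) 0
          ≡⟨ Σ<-Δ^-lengthSum (k ℕ.+ 0) (pow 0) m (m′ ∷ g) r m>0 L≡rm
               (Δ^-lengthSum-shifted≡0 0 (pow-polynomial 0) m>0 G′) (Δ^-lengthSum≡0 0 (δ-polynomial (pow-polynomial 0)) G) ⟩
        natℚ r * (Σ< L (λ n → Δ^ L (k ℕ.+ 0) (lengthSum (m′ ∷ g) (pow 0)) (n ℕ.+ m))
                  + Σ< L (Δ^ L (k ℕ.+ 0) (lengthSum (m ∷ m′ ∷ g) (δ (pow 0)))))
          ≡⟨ cong₂ (λ a b → natℚ r * (a + b)) (Σ<-Δ^-lengthSum-shifted 0 {k} {m} G′) (Σ<-Δ^-lengthSum-δpow0 (k ℕ.+ 0) m (m′ ∷ g)) ⟩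
        natℚ r * (K (m′ ∷ g) 0 + 0ℚ)  ≡⟨ cong (natℚ r *_) (ℚP.+-identityʳ _) ⟩
        natℚ r * K (m′ ∷ g) 0         ∎
      where open ≡-Reasoning

    K-∷-suc : ∀ {k m r} {g : Vec ℕ k} → Generators (m ∷ g) → L ≡ r ℕ.* m → ∀ p →
      K (m ∷ g) (suc p) ≡ natℚ r * (K g (suc p) + natℚ (suc p) * K (m ∷ g) p)
    K-∷-suc {zero} {m} {r} {[]} G@((m>0 , _) ∷ _) L≡rm p = begin
        K (m ∷ []) (suc p)
          ≡⟨ Σ<-Δ^-lengthSum p (pow (suc p)) m [] r m>0 L≡rm
               (Δ^-lengthSum-[]-shifted≡0 (suc p) (pow (suc p)) m>0) (Δ^-lengthSum≡0 (suc p) (δ-polynomial (pow-polynomial (suc p))) G) ⟩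
        natℚ r * (Σ< L (λ n → Δ^ L p (lengthSum [] (pow (suc p))) (n ℕ.+ m)) + Σ< L (Δ^ L p (lengthSum (m ∷ []) (δ (pow (suc p))))))
          ≡⟨ cong₂ (λ a b → natℚ r * (a + b)) (Σ<-vanish L _ (λ n _ → Δ^-lengthSum-[]-shifted≡0 p (pow (suc p)) m>0 n))
                                             (Σ<-Δ^-lengthSum-δpow p G refl) ⟩
        natℚ r * (0ℚ + natℚ (suc p) * K (m ∷ []) p)  ∎
      where open ≡-Reasoning
    K-∷-suc {suc k} {m} {r} {m′ ∷ g} G@((m>0 , _) ∷ G′) L≡rm p = begin
        K (m ∷ m′ ∷ g) (suc p)
          ≡⟨ Σ<-Δ^-lengthSum (k ℕ.+ suc p) (pow (suc p)) m (m′ ∷ g) r m>0 L≡rm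
               (Δ^-lengthSum-shifted≡0 (suc p) (pow-polynomial (suc p)) m>0 G′)
               (Δ^-lengthSum≡0 (suc p) (δ-polynomial (pow-polynomial (suc p))) G) ⟩
        natℚ r * (Σ< L (λ n → Δ^ L (k ℕ.+ suc p) (lengthSum (m′ ∷ g) (pow (suc p))) (n ℕ.+ m))
                  + Σ< L (Δ^ L (k ℕ.+ suc p) (lengthSum (m ∷ m′ ∷ g) (δ (pow (suc p))))))
          ≡⟨ cong₂ (λ a b → natℚ r * (a + b)) (Σ<-Δ^-lengthSum-shifted (suc p) {k} {m} G′)
                                             (Σ<-Δ^-lengthSum-δpow p G (ℕP.+-suc k p)) ⟩
        natℚ r * (K (m′ ∷ g) (suc p) + natℚ (suc p) * K (m ∷ m′ ∷ g) p)  ∎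
      where open ≡-Reasoning

    r*m≡L : ∀ {m r} → L ≡ r ℕ.* m → natℚ r * natℚ m ≡ natℚ L
    r*m≡L {m} {r} L≡rm = trans (sym (natℚ-* r m)) (cong natℚ (sym L≡rm))

    L*x≡r : ∀ {m r} → 0 < m → L ≡ r ℕ.* m → natℚ L * fracℕ 1 m ≡ natℚ r
    L*x≡r {m} {r} m>0 L≡rm = begin
        natℚ L * fracℕ 1 m             ≡⟨ cong (_* fracℕ 1 m) (sym (r*m≡L {m} {r} L≡rm)) ⟩
        natℚ r * natℚ m * fracℕ 1 m    ≡⟨ ℚP.*-assoc (natℚ r) (natℚ m) (fracℕ 1 m) ⟩
        natℚ r * (natℚ m * fracℕ 1 m)  ≡⟨ cong (natℚ r *_) (natℚ-*-fracℕ-inverse m>0) ⟩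
        natℚ r * 1ℚ                    ≡⟨ ℚP.*-identityʳ (natℚ r) ⟩
        natℚ r                         ∎
      where open ≡-Reasoning

    -- With x = 1/m and r = L/m, the recurrences for K match h_(p+1)(x, X) = x h_p(x, X) + h_(p+1)(X).
    K-formula : ∀ {k} (g : Vec ℕ k) → Generators g → ∀ p →
      K g p * natℚ (prodVec g) ≡ natℚ (L ^ (k ℕ.+ p)) * natℚ (p !) * h p (Vec.map (fracℕ 1) g)
    K-formula []      []   zero    = refl
    K-formula []      []   (suc p) = trans (ℚP.*-zeroˡ 1ℚ) (sym (ℚP.*-zeroʳ (natℚ (L ^ suc p) * natℚ (suc p !))))
    K-formula {suc k} (m ∷ g) G@((m>0 , divides r L≡rm) ∷ G′) zero = begin
        K (m ∷ g) 0 * natℚ (m ℕ.* Π)                         ≡⟨ cong₂ _*_ (K-∷-zero {k} {m} {r} {g} G L≡rm) (natℚ-* m Π) ⟩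
        natℚ r * K g 0 * (natℚ m * natℚ Π)
          ≡⟨ solve 4 (λ r a m q → r :* a :* (m :* q) := (r :* m) :* (a :* q)) refl (natℚ r) (K g 0) (natℚ m) (natℚ Π) ⟩
        (natℚ r * natℚ m) * (K g 0 * natℚ Π)                 ≡⟨ cong₂ _*_ (r*m≡L {m} {r} L≡rm) (K-formula g G′ 0) ⟩
        natℚ L * (natℚ (L ^ (k ℕ.+ 0)) * 1ℚ * h 0 X)         ≡⟨ cong (λ z → natℚ L * (natℚ (L ^ (k ℕ.+ 0)) * 1ℚ * z)) (h-0 X) ⟩
        natℚ L * (natℚ (L ^ (k ℕ.+ 0)) * 1ℚ * 1ℚ)
          ≡⟨ solve 2 (λ l q → l :* (q :* con 1ℚ :* con 1ℚ) := l :* q :* con 1ℚ :* con 1ℚ) refl (natℚ L) (natℚ (L ^ (k ℕ.+ 0))) ⟩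
        natℚ L * natℚ (L ^ (k ℕ.+ 0)) * 1ℚ * 1ℚ
          ≡⟨ cong₂ (λ a b → a * 1ℚ * b) (sym (natℚ-* L (L ^ (k ℕ.+ 0)))) (sym (h-0 (fracℕ 1 m ∷ X))) ⟩
        natℚ (L ^ (suc k ℕ.+ 0)) * 1ℚ * h 0 (fracℕ 1 m ∷ X)  ∎
      where
      open ≡-Reasoning
      Π = prodVec g
      X = Vec.map (fracℕ 1) g
    K-formula {suc k} (m ∷ g) G@((m>0 , divides r L≡rm) ∷ G′) (suc p) = begin
        K (m ∷ g) (suc p) * natℚ (m ℕ.* Π)
          ≡⟨ cong₂ _*_ (K-∷-suc {k} {m} {r} {g} G L≡rm p) (natℚ-* m Π) ⟩
        natℚ r * (A + k′ * B) * (natℚ m * natℚ Π)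
          ≡⟨ solve 6 (λ r A k B m q → r :* (A :+ k :* B) :* (m :* q) := (r :* m) :* (A :* q) :+ r :* k :* (B :* (m :* q))) refl
                     (natℚ r) A k′ B (natℚ m) (natℚ Π) ⟩
        (natℚ r * natℚ m) * (A * natℚ Π) + natℚ r * k′ * (B * (natℚ m * natℚ Π))
          ≡⟨ cong₂ (λ a b → a + natℚ r * k′ * b) (cong₂ _*_ (r*m≡L {m} {r} L≡rm) (K-formula g G′ (suc p)))
                                                 (trans (cong (B *_) (sym (natℚ-* m Π))) (K-formula (m ∷ g) G p)) ⟩
        l * (natℚ (L ^ (k ℕ.+ suc p)) * natℚ (suc p !) * H₁) + natℚ r * k′ * (Le * f * H₂)
          ≡⟨ cong₂ (λ a b → l * (a * b * H₁) + natℚ r * k′ * (Le * f * H₂))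
                   (cong (λ z → natℚ (L ^ z)) (ℕP.+-suc k p)) (natℚ-* (suc p) (p !)) ⟩
        l * (Le * (k′ * f) * H₁) + natℚ r * k′ * (Le * f * H₂)
          ≡⟨ cong (λ z → l * (Le * (k′ * f) * H₁) + z * k′ * (Le * f * H₂)) (sym (L*x≡r {m} {r} m>0 L≡rm)) ⟩
        l * (Le * (k′ * f) * H₁) + l * x * k′ * (Le * f * H₂)
          ≡⟨ solve 7 (λ l Le k f H₁ x H₂ → l :* (Le :* (k :* f) :* H₁) :+ l :* x :* k :* (Le :* f :* H₂)
                                        := (l :* Le) :* (k :* f) :* (x :* H₂ :+ H₁)) refl l Le k′ f H₁ x H₂ ⟩
        (l * Le) * (k′ * f) * (x * H₂ + H₁)
          ≡⟨ sym (cong₂ (λ a b → a * b * (x * H₂ + H₁))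
                   (trans (natℚ-* L (L ^ (k ℕ.+ suc p))) (cong (λ z → l * natℚ (L ^ z)) (ℕP.+-suc k p))) (natℚ-* (suc p) (p !))) ⟩
        natℚ (L ^ (suc k ℕ.+ suc p)) * natℚ (suc p !) * (x * H₂ + H₁)
          ≡⟨ cong (natℚ (L ^ (suc k ℕ.+ suc p)) * natℚ (suc p !) *_) (sym (h-∷ p x X)) ⟩
        natℚ (L ^ (suc k ℕ.+ suc p)) * natℚ (suc p !) * h (suc p) (x ∷ X)  ∎
      where
      open ≡-Reasoning
      Π = prodVec g
      X = Vec.map (fracℕ 1) g
      x = fracℕ 1 m
      l = natℚ L
      k′ = natℚ (suc p)
      f = natℚ (p !)
      Le = natℚ (L ^ (suc k ℕ.+ p))
      A = K g (suc p)
      B = K (m ∷ g) p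
      H₁ = h (suc p) X
      H₂ = h p (x ∷ X)

    Δ^-lengthSum-constant : ∀ {k} (g : Vec ℕ (suc k)) → Generators g → gcdVec g ≡ 1 → ∀ p n →
      Δ^ L (k ℕ.+ p) (lengthSum g (pow p)) n ≡ Δ^ L (k ℕ.+ p) (lengthSum g (pow p)) 0
    Δ^-lengthSum-constant {k} g G gcd≡1 p = periodic-1⇒constant (subst (λ z → Periodic z κ) gcd≡1 (periodic-gcdVec g periodic-in))
      where
      κ = Δ^ L (k ℕ.+ p) (lengthSum g (pow p))
      periodic-in : ∀ i → Periodic (lookup g i) κ
      periodic-in i n = begin
          κ (n ℕ.+ lookup g i)   ≡⟨ Δ^-cong L (k ℕ.+ p) to-front (n ℕ.+ lookup g i) ⟩
          κ′ (n ℕ.+ lookup g i)  ≡⟨ Δ^-lengthSum-periodic p (pow-polynomial p) (AllP.lookup⁺ G i ∷ All-removeAt G i) n ⟩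
          κ′ n                   ≡⟨ Δ^-cong L (k ℕ.+ p) to-front n ⟨
          κ n                    ∎
        where
        open ≡-Reasoning
        to-front = lengthSum-toFront g i (All.map proj₁ G) (pow p)
        κ′ = Δ^ L (k ℕ.+ p) (lengthSum (lookup g i ∷ removeAt g i) (pow p))

    -- Summing the constant over a period gives L κ = K g p, which K-formula evaluates.
    Δ^-lengthSum≡leading : ∀ {k} (g : Vec ℕ (suc k)) → 0 < L → Generators g → gcdVec g ≡ 1 → ∀ p n →
      Δ^ L (k ℕ.+ p) (lengthSum g (pow p)) n ≡ leadingCoeff g p * natℚ ((k ℕ.+ p) !) * natℚ (L ^ (k ℕ.+ p))
    Δ^-lengthSum≡leading {k} g@(_ ∷ _) L>0 G gcd≡1 p n = trans (Δ^-lengthSum-constant g G gcd≡1 p n)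
      (*-cancelʳ-natℚ L>0 (trans (ℚP.*-comm κ₀ l) (trans (*-cancelʳ-natℚ Π>0 LκΠ) (ℚP.*-comm l _))))
      where
      D = k ℕ.+ p
      κ₀ = Δ^ L D (lengthSum g (pow p)) 0
      C = leadingCoeff g p
      l = natℚ L
      Π>0 : 0 < prodVec g
      Π>0 = prodVec-pos g (All.map proj₁ G)
      N>0 : 0 < D ! ℕ.* prodVec g
      N>0 = ℕP.*-mono-≤ (ℕP.1≤n! D) Π>0
      LκΠ : (l * κ₀) * natℚ (prodVec g) ≡ (l * (C * natℚ (D !) * natℚ (L ^ D))) * natℚ (prodVec g)
      LκΠ = begin
          (l * κ₀) * Π̂
            ≡⟨ cong (_* Π̂) (sym (trans (Σ<-cong L (λ n → Δ^-lengthSum-constant g G gcd≡1 p n)) (Σ<-const L κ₀))) ⟩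
          K g p * Π̂                             ≡⟨ K-formula g G p ⟩
          natℚ (L ℕ.* L ^ D) * pf * hX           ≡⟨ cong (λ z → z * pf * hX) (natℚ-* L (L ^ D)) ⟩
          l * LD * pf * hX
            ≡⟨ solve 4 (λ l LD pf hX → l :* LD :* pf :* hX := l :* pf :* hX :* LD :* con 1ℚ) refl l LD pf hX ⟩
          l * pf * hX * LD * 1ℚ                  ≡⟨ cong (l * pf * hX * LD *_) (sym N*1/N≡1) ⟩
          l * pf * hX * LD * ((Df * Π̂) * iN)
            ≡⟨ solve 7 (λ l pf hX LD Df Π iN → l :* pf :* hX :* LD :* ((Df :* Π) :* iN) := (l :* ((pf :* iN :* hX) :* Df :* LD)) :* Π)
                       refl l pf hX LD Df Π̂ iN ⟩
          (l * ((pf * iN * hX) * Df * LD)) * Π̂  ≡⟨ cong (λ z → (l * ((z * hX) * Df * LD)) * Π̂) (sym (fracℕ-split (p !) N>0)) ⟩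
          (l * (C * Df * LD)) * Π̂               ∎
        where
        open ≡-Reasoning
        Π̂ = natℚ (prodVec g)
        pf = natℚ (p !)
        Df = natℚ (D !)
        LD = natℚ (L ^ D)
        hX = h p (Vec.map (fracℕ 1) g)
        iN = fracℕ 1 (D ! ℕ.* prodVec g)
        N*1/N≡1 : (Df * Π̂) * iN ≡ 1ℚ
        N*1/N≡1 = trans (cong (_* iN) (sym (natℚ-* (D !) (prodVec g)))) (natℚ-*-fracℕ-inverse N>0)

    lengthSum-quasipolynomial : ∀ {k} (g : Vec ℕ (suc k)) → 0 < L → Generators g → gcdVec g ≡ 1 → ∀ p →
      Quasipolynomial L (k ℕ.+ p) (λ n → lengthSum g (pow p) n - leadingCoeff g p * natℚ (n ^ (k ℕ.+ p)))
    lengthSum-quasipolynomial {k} g L>0 G gcd≡1 p = Δ^≡0⇒QP L>0 D λ n → begin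
        Δ^ L D (λ n → lengthSum g (pow p) n - C * natℚ (n ^ D)) n
          ≡⟨ Δ^-sub L D (lengthSum g (pow p)) (λ n → C * natℚ (n ^ D)) n ⟩
        Δ^ L D (lengthSum g (pow p)) n - Δ^ L D (λ n → C * natℚ (n ^ D)) n
          ≡⟨ cong₂ _-_ (Δ^-lengthSum≡leading g L>0 G gcd≡1 p n) (Δ^-monomial D {λ _ → C} (λ _ → refl) n) ⟩
        C * natℚ (D !) * natℚ (L ^ D) - C * natℚ (D !) * natℚ (L ^ D)
          ≡⟨ ℚP.+-inverseʳ (C * natℚ (D !) * natℚ (L ^ D)) ⟩
        0ℚ  ∎
      where
      open ≡-Reasoning
      D = k ℕ.+ p
      C = leadingCoeff g p

  QP-difference-expansion : ∀ {L d} (f a : ℕ → ℚ) (q : Quasipolynomial L d (λ n → f n - a n)) → ∀ n →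
    f n ≡ a n + sumBelow d (λ i → Quasipolynomial.coeff q i n * natℚ (n ^ i))
  QP-difference-expansion {d = d} f a q n = begin
      f n
        ≡⟨ solve 2 (λ x y → x := y :+ (x :- y)) refl (f n) (a n) ⟩
      a n + (f n - a n)                                                    ≡⟨ cong (a n +_) (Quasipolynomial.expansion q n) ⟩
      a n + poly d (Quasipolynomial.coeff q) n                             ≡⟨ cong (a n +_) (sumL-applyUpTo _ (λ i → i) d) ⟨
      a n + sumBelow d (λ i → Quasipolynomial.coeff q i n * natℚ (n ^ i))  ∎
    where open ≡-Reasoning

open LengthSums

open import Data.Nat using (ℕ; _+_; _*_; _∸_; _^_; _≤_; _<_; _!)
open import Data.Fin using (Fin) renaming (_<_ to _<ᶠ_)
open import Data.Vec using (Vec; lookup; map)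
open import Data.Product using (Σ; _×_)
open import Data.Rational using (ℚ) renaming (_+_ to _+ℚ_; _*_ to _*ℚ_)
open import Relation.Binary.PropositionalEquality using (_≡_)

open import Data.Nat using (zero; suc)
open import Data.Product using (_,_)
open import Relation.Binary.PropositionalEquality using (trans)
open import Data.Vec.Relation.Unary.All.Properties using (lookup⁻)

theorem2 : (k : ℕ) → 3 ≤ k → (g : Vec ℕ k) →
    (∀ i → 0 < lookup g i) →
    (∀ (i j : Fin k) → i <ᶠ j → lookup g i < lookup g j) →
    gcdVec g ≡ 1 →
    (p : ℕ) →
    Σ (ℕ → ℕ → ℚ) λ c →
      (∀ i n → c i (n + lcmVec g) ≡ c i n) ×
      (∀ n → natℚ (lengthPowerSum g p n) ≡
        (fracℕ (p !) (((k + p ∸ 1) !) * prodVec g)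
          *ℚ h p (map (fracℕ 1) g)
          *ℚ natℚ (n ^ (k + p ∸ 1)))
        +ℚ sumBelow (k + p ∸ 1) (λ i → c i n *ℚ natℚ (n ^ i)))
theorem2 (suc k) _ g pos _ gcd≡1 p =
  coeff , periodic , λ n → trans (lengthPowerSum≡lengthSum g (lookup⁻ pos) p n)
                                 (QP-difference-expansion (lengthSum g (pow p)) (λ n → C *ℚ natℚ (n ^ (k + p))) q n)
  where
  C = leadingCoeff g p
  q = lengthSum-quasipolynomial (lcmVec g) g (lcmVec-pos g (lookup⁻ pos))
        (lookup⁻ (λ i → pos i , lookup∣lcmVec g i)) gcd≡1 p
  open Quasipolynomial q
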